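{- For every $n\ge 1$, $|\mathcal{DRS}_n(132)|=S_n$, where $S_n$ is the number of Motzkin paths of length $n$ with no two consecutive up steps.
   Context: For $\sigma\in\mathfrak{S}_n$, a double descent is an index $i$ with $\sigma_i>\sigma_{i+1}>\sigma_{i+2}$. The permutation $\sigma$ is simsun if for every $k$, the subword of $\sigma$ consisting of the letters in $\{1,\dots,k\}$ (in the order they appear in $\sigma$) has no double descent. For $\omega\in\mathfrak{S}_t$, $\sigma$ contains an $\omega$-pattern if there are indices $i_1<\cdots<i_t$ with $\sigma_{i_j}<\sigma_{i_k}$ iff $\omega_j<\omega_k$; otherwise $\sigma$ avoids $\omega$. $\mathcal{DRS}_n(\omega)$ is the set of $\sigma\in\mathfrak{S}_n$ such that $\sigma$ is $\omega$-avoiding and simsun and $\sigma^{ -1}$ is simsun. A Motzkin path of length $n$ is a lattice path from $(0,0)$ to $(n,0)$ with up steps $(1,1)$, down steps $(1,-1)$ and level steps $(1,0)$ never going below the $x$-axis. -}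

module Defs where

open import Data.Bool using (Bool; true; false; _∧_; _∨_; not; if_then_else_)
open import Data.Nat using (ℕ; zero; suc; _+_; _<ᵇ_; _≡ᵇ_)
open import Data.List using (List; []; _∷_; length; map; concatMap; filterᵇ; applyUpTo; zip)
open import Data.Bool.ListAction using (all; any)

-- Words and permutations.  A permutation σ ∈ 𝔖ₙ is represented by its
-- one-line notation σ₁ σ₂ … σₙ, a list of naturals that contains each of
-- 1,…,n exactly once (and has length n).

Word : Set
Word = List ℕ

[1…_] : ℕ → List ℕ
[1… n ] = applyUpTo suc n

count : ℕ → Word → ℕ
count k []       = zero
count k (x ∷ xs) = if k ≡ᵇ x then suc (count k xs) else count k xs

isPerm : ℕ → Word → Bool
isPerm n w = (length w ≡ᵇ n) ∧ all (λ k → count k w ≡ᵇ 1) [1… n ]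

words : ℕ → ℕ → List Word
words n zero    = [] ∷ []
words n (suc m) = concatMap (λ a → map (a ∷_) (words n m)) [1… n ]

perms : ℕ → List Word
perms n = filterᵇ (isPerm n) (words n n)

-- 1-based position of the letter k in w (first occurrence)
position : ℕ → Word → ℕ
position k []       = zero
position k (x ∷ xs) = if k ≡ᵇ x then 1 else suc (position k xs)

inverse : ℕ → Word → Word
inverse n σ = map (λ k → position k σ) [1… n ]

hasDoubleDescent : Word → Bool
hasDoubleDescent (a ∷ b ∷ c ∷ rest) =
  ((b <ᵇ a) ∧ (c <ᵇ b)) ∨ hasDoubleDescent (b ∷ c ∷ rest)
hasDoubleDescent _ = false

restrict : ℕ → Word → Word
restrict k []       = []
restrict k (x ∷ xs) = if x <ᵇ suc k then x ∷ restrict k xs else restrict k xs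

-- σ ∈ 𝔖ₙ is simsun iff for every k ∈ {1,…,n} the restriction has no
-- double descent (for k > n the restriction is σ itself, for k = 0 empty)
isSimsun : ℕ → Word → Bool
isSimsun n σ = all (λ k → not (hasDoubleDescent (restrict k σ))) [1… n ]

subseqs : ℕ → Word → List Word
subseqs zero    _        = [] ∷ []
subseqs (suc t) []       = []
subseqs (suc t) (x ∷ xs) = map (x ∷_) (subseqs t xs) ++ subseqs (suc t) xs
  where open import Data.List using (_++_)

orderIso : Word → Word → Bool
orderIso ω u =
  (length u ≡ᵇ length ω) ∧
  all (λ p → all (λ q → eqB (Data.Product.proj₁ p <ᵇ Data.Product.proj₁ q)
                            (Data.Product.proj₂ p <ᵇ Data.Product.proj₂ q))
                 (zip u ω))
      (zip u ω)
  where
  import Data.Product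
  eqB : Bool → Bool → Bool
  eqB true  b = b
  eqB false b = not b

contains : Word → Word → Bool
contains ω σ = any (orderIso ω) (subseqs (length ω) σ)

avoids : Word → Word → Bool
avoids ω σ = not (contains ω σ)

isDRS : ℕ → Word → Word → Bool
isDRS n ω σ = avoids ω σ ∧ isSimsun n σ ∧ isSimsun n (inverse n σ)

DRS : ℕ → Word → List Word
DRS n ω = filterᵇ (isDRS n ω) (perms n)

data Step : Set where
  U D L : Step   -- up (1,1), down (1,-1), level (1,0)

allPaths : ℕ → List (List Step)
allPaths zero    = [] ∷ []
allPaths (suc m) = concatMap (λ s → map (s ∷_) (allPaths m)) (U ∷ D ∷ L ∷ [])

validFrom : ℕ → List Step → Bool
validFrom zero    []       = true
validFrom (suc _) []       = false
validFrom h       (U ∷ p)  = validFrom (suc h) p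
validFrom zero    (D ∷ p)  = false
validFrom (suc h) (D ∷ p)  = validFrom h p
validFrom h       (L ∷ p)  = validFrom h p

isMotzkin : List Step → Bool
isMotzkin = validFrom zero

noUU : List Step → Bool
noUU (U ∷ U ∷ p) = false
noUU (_ ∷ p)     = noUU p
noUU []          = true

S : ℕ → ℕ
S n = length (filterᵇ (λ p → isMotzkin p ∧ noUU p) (allPaths n))

module Submission where

-- |DRS_n(132)| = S_n : both sides are counted by one family of binary trees.
--
-- A binary tree t is read as the permutation
--    perm t, where perm (node a b) = (perm a, shifted above perm b) · max · perm b.
--    perm is injective and hits every 132-avoiding permutation of an interval
--    (perm-injective, avoider⇒perm: cut at the maximum).
-- 2. Translation.  Restricting perm t to its letters ≤ k gives perm of a
--    restriction tree r ≼ t, and double descents of perm t are computed on the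
--    tree (hasDD); so perm t is simsun iff t is Simsun.  The inverse of perm t
--    is perm (star t), hence perm t ∈ DRS_n(132) iff t is BiSimsun.
-- 3. Grammar.  How descents behave under the skew sum (hasDD-skew, …) gives the
--    root analysis BiSimsun-node, which unfolds into four mutually recursive
--    classes Gram, GramL, GramR, GramLR with Gram = BiSimsun (Gram⟺BiSimsun).
-- 4. Paths.  Grammar trees are coded (code, codeL, …) size-preservingly into
--    Motzkin paths without UU; a first-return decomposition shows that the
--    coding is injective and onto (code-injective, parse).
-- 5. Counting.  Injections in both directions between the duplicate-free lists
--    DRS n 132 and the list of such paths give equal lengths (theorem4p2).

open import Defs
open import Data.Bool using (Bool; true; false; _∧_; _∨_; not; if_then_else_)
open import Data.Bool.Properties using (∧-conicalˡ; ∧-conicalʳ; ∨-conicalˡ; ∨-conicalʳ; ∨-assoc; ∨-comm; ∧-zeroʳ; T-≡)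
open import Data.Bool.ListAction using (all; any)
open import Data.Nat using (ℕ; zero; suc; _+_; _≤_; _<_; z≤n; s≤s; _<ᵇ_; _≡ᵇ_; _≟_)
open import Data.Nat.Properties
  using (+-assoc; +-comm; +-suc; +-identityʳ; suc-injective; ≤-refl; ≤-reflexive; ≤-trans; ≤-antisym; ≤-pred;
         <-irrefl; <-asym; <-trans; ≤-<-trans; <-≤-trans; <⇒≤; ≰⇒>; ≤∧≢⇒<; n≤1+n; n<1+n; m≤m+n; m≤n+m;
         +-monoʳ-≤; +-monoʳ-<; 0≢1+n; _≤?_; <-cmp; ≡ᵇ⇒≡)
open import Data.Nat.Tactic.RingSolver using (solve-∀)
open import Data.List using (List; []; _∷_; length; _++_; map; applyUpTo; filterᵇ; concatMap)
open import Data.List.Properties using (length-++; ++-assoc; map-++; ∷-injective; ∷-injectiveʳ; map-applyUpTo; applyUpTo-∷ʳ)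
open import Data.List.Membership.Propositional using (_∈_; _∉_; lose; find)
open import Data.List.Membership.Propositional.Properties
  using (∈-++⁺ˡ; ∈-++⁺ʳ; ∈-++⁻; ∈-∃++; ∈-map⁺; ∈-map⁻; ∈-applyUpTo⁺; ∈-applyUpTo⁻; ∈-concatMap⁺; ∈-concatMap⁻;
         ∈-filter⁺; ∈-filter⁻)
open import Data.List.Membership.DecPropositional _≟_ using (_∈?_)
open import Data.List.Relation.Unary.Any using (here; there)
open import Data.List.Relation.Binary.Sublist.Propositional using (_⊆_; []; _∷_; _∷ʳ_; ⊆-refl; ⊆-trans; lookup; from∈)
open import Data.List.Relation.Binary.Sublist.Propositional.Properties using ([]⊆-universal; ++⁺; ++⁺ˡ; ++⁺ʳ)
open import Data.List.Relation.Unary.All using (All; []; _∷_)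
import Data.List.Relation.Unary.All as All
open import Data.List.Relation.Unary.AllPairs using ([]; _∷_)
open import Data.List.Relation.Unary.Unique.Propositional using (Unique)
import Data.List.Relation.Unary.Unique.Propositional.Properties as Unique
open import Data.Product using (Σ; _×_; _,_; proj₁; proj₂; map₁)
open import Data.Sum using (_⊎_; inj₁; inj₂)
open import Data.Unit using (⊤; tt)
open import Data.Empty using (⊥; ⊥-elim)
open import Function.Bundles using (Equivalence)
open import Relation.Nullary using (¬_; yes; no)
open import Relation.Nullary.Decidable using (T?)
open import Relation.Binary.Definitions using (tri<; tri≈; tri>)
open import Relation.Binary.PropositionalEquality using (_≡_; _≢_; refl; sym; trans; cong; cong₂; subst; subst₂; module ≡-Reasoning)
open ≡-Reasoning

infix 2 _⟺_
_⟺_ : Set → Set → Set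
A ⟺ B = (A → B) × (B → A)

true≢false : true ≢ false
true≢false ()

∧-true⁻ : ∀ x y → x ∧ y ≡ true → x ≡ true × y ≡ true
∧-true⁻ x y e = ∧-conicalˡ x y e , ∧-conicalʳ x y e

∧-true⁺ : ∀ {x y} → x ≡ true → y ≡ true → x ∧ y ≡ true
∧-true⁺ refl q = q

∨-false⁻ : ∀ x y → x ∨ y ≡ false → x ≡ false × y ≡ false
∨-false⁻ x y e = ∨-conicalˡ x y e , ∨-conicalʳ x y e

∨-false⁺ : ∀ {x y} → x ≡ false → y ≡ false → x ∨ y ≡ false
∨-false⁺ refl q = q

not-true : ∀ b → not b ≡ true → b ≡ false
not-true false _ = refl

<ᵇ-true : ∀ {m n} → m < n → (m <ᵇ n) ≡ true
<ᵇ-true {zero} {suc n} _ = refl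
<ᵇ-true {suc m} {suc n} (s≤s p) = <ᵇ-true p

<ᵇ-false : ∀ {m n} → n ≤ m → (m <ᵇ n) ≡ false
<ᵇ-false {m} {zero} _ = refl
<ᵇ-false {suc m} {suc n} (s≤s p) = <ᵇ-false p

≡ᵇ-refl : ∀ k → (k ≡ᵇ k) ≡ true
≡ᵇ-refl zero = refl
≡ᵇ-refl (suc k) = ≡ᵇ-refl k

≡ᵇ-false : ∀ {k x} → k ≢ x → (k ≡ᵇ x) ≡ false
≡ᵇ-false {zero} {zero} ne = ⊥-elim (ne refl)
≡ᵇ-false {zero} {suc x} ne = refl
≡ᵇ-false {suc k} {zero} ne = refl
≡ᵇ-false {suc k} {suc x} ne = ≡ᵇ-false {k} {x} (λ e → ne (cong suc e))

≡ᵇ-true⁻ : ∀ {k x} → (k ≡ᵇ x) ≡ true → k ≡ x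
≡ᵇ-true⁻ {k} {x} e = ≡ᵇ⇒≡ k x (Equivalence.from T-≡ e)

all-true⁻ : ∀ {A : Set} (p : A → Bool) xs → all p xs ≡ true → ∀ {x} → x ∈ xs → p x ≡ true
all-true⁻ p (y ∷ ys) e (here refl) = proj₁ (∧-true⁻ (p y) _ e)
all-true⁻ p (y ∷ ys) e (there q) = all-true⁻ p ys (proj₂ (∧-true⁻ (p y) _ e)) q

all-true⁺ : ∀ {A : Set} (p : A → Bool) xs → (∀ {x} → x ∈ xs → p x ≡ true) → all p xs ≡ true
all-true⁺ p [] h = refl
all-true⁺ p (y ∷ ys) h = ∧-true⁺ (h (here refl)) (all-true⁺ p ys (λ q → h (there q)))

any-false⁺ : ∀ {A : Set} (p : A → Bool) xs → (∀ {x} → x ∈ xs → p x ≡ false) → any p xs ≡ false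
any-false⁺ p [] h = refl
any-false⁺ p (y ∷ ys) h rewrite h (here refl) = any-false⁺ p ys (λ q → h (there q))

any-true⁺ : ∀ {A : Set} (p : A → Bool) xs {x} → x ∈ xs → p x ≡ true → any p xs ≡ true
any-true⁺ p (y ∷ ys) (here refl) e rewrite e = refl
any-true⁺ p (y ∷ ys) (there q) e with p y
... | true = refl
... | false = any-true⁺ p ys q e

∈-filterᵇ⁺ : ∀ {A : Set} (p : A → Bool) xs {x} → x ∈ xs → p x ≡ true → x ∈ filterᵇ p xs
∈-filterᵇ⁺ p xs q e = ∈-filter⁺ (λ x → T? (p x)) q (Equivalence.from T-≡ e)

∈-filterᵇ⁻ : ∀ {A : Set} (p : A → Bool) xs {x} → x ∈ filterᵇ p xs → x ∈ xs × p x ≡ true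
∈-filterᵇ⁻ p xs q with ∈-filter⁻ (λ x → T? (p x)) {xs = xs} q
... | q′ , t = q′ , Equivalence.to T-≡ t

-- Binary trees.  A tree t of size n stands for the 132-avoiding permutation
-- perm 0 t of {1,…,n}, defined below.
data Tree : Set where
  leaf : Tree
  node : Tree → Tree → Tree

size : Tree → ℕ
size leaf = zero
size (node a b) = suc (size a + size b)

-- skew a b grafts b onto the rightmost leaf of a; on permutations it is the
-- skew sum (perm a shifted above perm b, followed by perm b), see perm-skew.
skew : Tree → Tree → Tree
skew leaf B = B
skew (node a c) B = node a (skew c B)

-- The tree of the inverse permutation, see inverse-perm.
star : Tree → Tree
star leaf = leaf
star (node a b) = skew (star b) (node (star a) leaf)

isNode : Tree → Bool
isNode leaf = false
isNode (node _ _) = true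

isSingleton : Tree → Bool
isSingleton leaf = false
isSingleton (node a leaf) = not (isNode a)
isSingleton (node a (node _ _)) = false

-- Descents of perm t read off the tree (perm-startsDesc, perm-hasDD): perm t
-- starts with a descent, has a double descent, ends with a descent.
startsDesc : Tree → Bool
startsDesc leaf = false
startsDesc (node leaf b) = isNode b
startsDesc (node (node x y) b) = startsDesc (node x y)

hasDD : Tree → Bool
hasDD leaf = false
hasDD (node a b) = hasDD a ∨ (hasDD b ∨ startsDesc b)

endsDesc : Tree → Bool
endsDesc leaf = false
endsDesc (node a leaf) = false
endsDesc (node a (node leaf leaf)) = true
endsDesc (node a (node leaf (node x y))) = endsDesc (node leaf (node x y))
endsDesc (node a (node (node x y) z)) = endsDesc (node (node x y) z)

-- Restriction trees: r ≼ t iff perm r is the restriction of perm t to its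
-- letters ≤ k for some k (restrict-perm, restriction-perm).  Cutting inside the
-- right subtree keeps a restriction of it; cutting between the right subtree
-- and the root keeps all of b below a restriction of a.
data _≼_ : Tree → Tree → Set where
  self : ∀ {t} → t ≼ t
  right : ∀ {r a b} → r ≼ b → r ≼ node a b
  left : ∀ {r a b} → r ≼ a → skew r b ≼ node a b

-- perm t is simsun.
Simsun : Tree → Set
Simsun t = ∀ r → r ≼ t → hasDD r ≡ false

-- No restriction of perm t ends with a descent.
NoEndDesc : Tree → Set
NoEndDesc t = ∀ r → r ≼ t → endsDesc r ≡ false

skew-leaf : ∀ t → skew t leaf ≡ t
skew-leaf leaf = refl
skew-leaf (node a b) = cong (node a) (skew-leaf b)

skew-assoc : ∀ a b c → skew (skew a b) c ≡ skew a (skew b c)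
skew-assoc leaf b c = refl
skew-assoc (node x y) b c = cong (node x) (skew-assoc y b c)

size-skew : ∀ a b → size (skew a b) ≡ size a + size b
size-skew leaf b = refl
size-skew (node x y) b rewrite size-skew y b | +-assoc (size x) (size y) (size b) = refl

≼-leaf : ∀ {r} → r ≼ leaf → r ≡ leaf
≼-leaf self = refl

≼-skewʳ : ∀ {r} A {B} → r ≼ B → r ≼ skew A B
≼-skewʳ leaf p = p
≼-skewʳ (node a c) p = right (≼-skewʳ c p)

≼-skewˡ : ∀ {r A B} → r ≼ A → skew r B ≼ skew A B
≼-skewˡ self = self
≼-skewˡ (right p) = right (≼-skewˡ p)
≼-skewˡ {B = B} (left {r} {a} {c} p) rewrite skew-assoc r c B = left p

≼-skew⁻ : ∀ {r} A B → r ≼ skew A B → r ≼ B ⊎ Σ Tree (λ r′ → r′ ≼ A × r ≡ skew r′ B)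
≼-skew⁻ leaf B p = inj₁ p
≼-skew⁻ (node a c) B self = inj₂ (node a c , self , refl)
≼-skew⁻ (node a c) B (right p) with ≼-skew⁻ c B p
... | inj₁ q = inj₁ q
... | inj₂ (r′ , q , e) = inj₂ (r′ , right q , e)
≼-skew⁻ (node a c) B (left {r} p) = inj₂ (skew r c , left p , sym (skew-assoc r c B))

≼-isNode : ∀ {r A} → r ≼ A → isNode r ≡ true → isNode A ≡ true
≼-isNode {node _ _} {leaf} () _
≼-isNode {node _ _} {node _ _} p _ = refl

-- The permutation of a tree, with values in (lo, lo + size t]: the left
-- subtree takes the values above those of the right subtree, and the root
-- carries the maximum.  Such words avoid 132 (perm-Avoids132), and every
-- 132-avoider arises (avoider⇒perm) exactly once (perm-injective).
perm : ℕ → Tree → List ℕ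
perm lo leaf = []
perm lo (node a b) = perm (lo + size b) a ++ (lo + size (node a b)) ∷ perm lo b

-- The root value is one above the largest value of the left subtree.
root-value : ∀ lo a b → lo + suc (a + b) ≡ suc (lo + b + a)
root-value = solve-∀

perm-length : ∀ lo t → length (perm lo t) ≡ size t
perm-length lo leaf = refl
perm-length lo (node a b) rewrite length-++ (perm (lo + size b) a) {(lo + size (node a b)) ∷ perm lo b}
  | perm-length (lo + size b) a | perm-length lo b = +-suc (size a) (size b)

Within : ℕ → ℕ → List ℕ → Set
Within lo hi w = ∀ {v} → v ∈ w → lo < v × v ≤ hi

perm-within : ∀ lo t → Within lo (lo + size t) (perm lo t)
perm-within lo leaf ()
perm-within lo (node a b) p with ∈-++⁻ (perm (lo + size b) a) p
... | inj₁ q = ≤-<-trans (m≤m+n lo (size b)) (proj₁ (perm-within (lo + size b) a q))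
             , ≤-trans (proj₂ (perm-within (lo + size b) a q)) (≤-trans (n≤1+n _) (≤-reflexive (sym (root-value lo (size a) (size b)))))
... | inj₂ (here refl) = subst (lo <_) (sym (+-suc lo (size a + size b))) (s≤s (m≤m+n lo _)) , ≤-refl
... | inj₂ (there q) = proj₁ (perm-within lo b q)
                     , ≤-trans (proj₂ (perm-within lo b q)) (+-monoʳ-≤ lo (≤-trans (m≤n+m (size b) (size a)) (n≤1+n _)))

root-above-left : ∀ lo a b → lo + size b + size a < lo + size (node a b)
root-above-left lo a b rewrite root-value lo (size a) (size b) = ≤-refl

perm-left<root : ∀ lo a b {v} → v ∈ perm (lo + size b) a → v < lo + size (node a b)
perm-left<root lo a b p = ≤-<-trans (proj₂ (perm-within _ a p)) (root-above-left lo a b)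

perm-right<root : ∀ lo a b {v} → v ∈ perm lo b → v < lo + size (node a b)
perm-right<root lo a b p = ≤-<-trans (proj₂ (perm-within lo b p)) (≤-<-trans (m≤m+n _ (size a)) (root-above-left lo a b))

perm-complete : ∀ lo t v → lo < v → v ≤ lo + size t → v ∈ perm lo t
perm-complete lo leaf v l u rewrite +-identityʳ lo = ⊥-elim (<-irrefl refl (<-≤-trans l u))
perm-complete lo (node a b) v l u with v ≤? lo + size b
... | yes p = ∈-++⁺ʳ _ (there (perm-complete lo b v l p))
... | no p with v ≤? lo + size b + size a
... | yes q = ∈-++⁺ˡ (perm-complete (lo + size b) a v (≰⇒> p) q)
... | no q = ∈-++⁺ʳ _ (here (≤-antisym u (subst (_≤ v) (sym (root-value lo (size a) (size b))) (≰⇒> q))))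

perm-unique : ∀ lo t → Unique (perm lo t)
perm-unique lo leaf = []
perm-unique lo (node a b) = Unique.++⁺ (perm-unique (lo + size b) a) (All.tabulate root∉right ∷ perm-unique lo b) disjoint
  where
  root∉right : ∀ {v} → v ∈ perm lo b → lo + size (node a b) ≢ v
  root∉right q e = <-irrefl (sym e) (perm-right<root lo a b q)
  disjoint : ∀ {v} → ¬ (v ∈ perm (lo + size b) a × v ∈ (lo + size (node a b)) ∷ perm lo b)
  disjoint (p , here e) = <-irrefl e (perm-left<root lo a b p)
  disjoint (p , there q) = <-irrefl refl (<-≤-trans (proj₁ (perm-within _ a p)) (proj₂ (perm-within lo b q)))

skew-root-value : ∀ lo x y B → lo + suc (x + (y + B)) ≡ lo + B + suc (x + y)
skew-root-value = solve-∀

skew-left-value : ∀ lo y B → lo + (y + B) ≡ lo + B + y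
skew-left-value = solve-∀

perm-skew : ∀ lo A B → perm lo (skew A B) ≡ perm (lo + size B) A ++ perm lo B
perm-skew lo leaf B = refl
perm-skew lo (node x y) B
  rewrite perm-skew lo y B | size-skew y B | skew-root-value lo (size x) (size y) (size B) | skew-left-value lo (size y) (size B)
  = sym (++-assoc (perm (lo + size B + size y) x) _ (perm lo B))

perm-shift : ∀ c lo t → perm (c + lo) t ≡ map (c +_) (perm lo t)
perm-shift c lo leaf = refl
perm-shift c lo (node a b) rewrite map-++ (c +_) (perm (lo + size b) a) ((lo + size (node a b)) ∷ perm lo b)
  | +-assoc c lo (size b) | +-assoc c lo (size (node a b)) | perm-shift c (lo + size b) a | perm-shift c lo b = refl

perm-shift₀ : ∀ c t → perm c t ≡ map (c +_) (perm 0 t)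
perm-shift₀ c t = trans (cong (λ lo → perm lo t) (sym (+-identityʳ c))) (perm-shift c 0 t)

length-≤-injection : ∀ {A B : Set} (as : List A) (bs : List B) → Unique as →
  (g : ∀ {a} → a ∈ as → B) → (∀ {a} (p : a ∈ as) → g p ∈ bs) →
  (∀ {a a′} (p : a ∈ as) (p′ : a′ ∈ as) → g p ≡ g p′ → a ≡ a′) → length as ≤ length bs
length-≤-injection [] bs _ g g∈ g-inj = z≤n
length-≤-injection (a ∷ as) bs (a∉ ∷ u) g g∈ g-inj with ∈-∃++ (g∈ (here refl))
... | us , vs , refl = subst (suc (length as) ≤_) (sym length-bs)
      (s≤s (length-≤-injection as (us ++ vs) u (λ p → g (there p)) g∈′ (λ p p′ e → g-inj (there p) (there p′) e)))
  where
  length-bs : length (us ++ g (here refl) ∷ vs) ≡ suc (length (us ++ vs))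
  length-bs rewrite length-++ us {g (here refl) ∷ vs} | length-++ us {vs} = +-suc (length us) (length vs)
  g∈′ : ∀ {a′} (p : a′ ∈ as) → g (there p) ∈ us ++ vs
  g∈′ p with ∈-++⁻ us (g∈ (there p))
  ... | inj₁ q = ∈-++⁺ˡ q
  ... | inj₂ (here e) = ⊥-elim (All.lookup a∉ p (g-inj (here refl) (there p) (sym e)))
  ... | inj₂ (there q) = ∈-++⁺ʳ us q

length-≤-subset : ∀ {A : Set} (as bs : List A) → Unique as → (∀ {v} → v ∈ as → v ∈ bs) → length as ≤ length bs
length-≤-subset as bs u h = length-≤-injection as bs u (λ {a} _ → a) h (λ _ _ e → e)

-- The right comb; its permutation  interval lo k  lists the values lo+k, …, lo+1.
comb : ℕ → Tree
comb zero = leaf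
comb (suc k) = node leaf (comb k)

size-comb : ∀ k → size (comb k) ≡ k
size-comb zero = refl
size-comb (suc k) = cong suc (size-comb k)

interval : ℕ → ℕ → List ℕ
interval lo k = perm lo (comb k)

interval-length : ∀ lo k → length (interval lo k) ≡ k
interval-length lo k = trans (perm-length lo (comb k)) (size-comb k)

interval-within : ∀ lo k → Within lo (lo + k) (interval lo k)
interval-within lo k = subst (λ j → Within lo (lo + j) (interval lo k)) (size-comb k) (perm-within lo (comb k))

interval-complete : ∀ lo k {v} → lo < v → v ≤ lo + k → v ∈ interval lo k
interval-complete lo k {v} l h = perm-complete lo (comb k) v l (subst (λ j → v ≤ lo + j) (sym (size-comb k)) h)

-- Pigeonhole: a duplicate-free list of k values in (lo, lo + k] contains all of them.
Within-full : ∀ lo k zs → Unique zs → Within lo (lo + k) zs → length zs ≡ k →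
  ∀ {v} → lo < v → v ≤ lo + k → v ∈ zs
Within-full lo k zs u w len {v} l h with v ∈? zs
... | yes v∈ = v∈
... | no v∉ = ⊥-elim (<-irrefl refl (subst (suc k ≤_) (interval-length lo k) tooMany))
  where
  v∷zs⊆ : ∀ {x} → x ∈ v ∷ zs → x ∈ interval lo k
  v∷zs⊆ (here refl) = interval-complete lo k l h
  v∷zs⊆ (there q) = interval-complete lo k (proj₁ (w q)) (proj₂ (w q))
  tooMany : suc k ≤ length (interval lo k)
  tooMany = subst (_≤ length (interval lo k)) (cong suc len)
    (length-≤-subset (v ∷ zs) _ (All.tabulate (λ q e → v∉ (subst (_∈ zs) (sym e) q)) ∷ u) v∷zs⊆)

∈-subseqs⁻ : ∀ t w {u} → u ∈ subseqs t w → u ⊆ w × length u ≡ t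
∈-subseqs⁻ zero w (here refl) = []⊆-universal w , refl
∈-subseqs⁻ (suc t) (x ∷ xs) p with ∈-++⁻ (map (x ∷_) (subseqs t xs)) p
... | inj₁ q with ∈-map⁻ (x ∷_) q
... | v , vin , refl = refl ∷ proj₁ (∈-subseqs⁻ t xs vin) , cong suc (proj₂ (∈-subseqs⁻ t xs vin))
∈-subseqs⁻ (suc t) (x ∷ xs) p | inj₂ q = x ∷ʳ proj₁ (∈-subseqs⁻ (suc t) xs q) , proj₂ (∈-subseqs⁻ (suc t) xs q)

∈-subseqs⁺ : ∀ {u w} → u ⊆ w → u ∈ subseqs (length u) w
∈-subseqs⁺ {[]} _ = here refl
∈-subseqs⁺ {x ∷ xs} (y ∷ʳ p) = ∈-++⁺ʳ (map (y ∷_) (subseqs (length xs) _)) (∈-subseqs⁺ p)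
∈-subseqs⁺ {x ∷ xs} (refl ∷ p) = ∈-++⁺ˡ (∈-map⁺ (x ∷_) (∈-subseqs⁺ p))

⊆-++⁻ : ∀ (xs zs : List ℕ) {u} → u ⊆ xs ++ zs →
  Σ (List ℕ) (λ u₁ → Σ (List ℕ) (λ u₂ → u ≡ u₁ ++ u₂ × u₁ ⊆ xs × u₂ ⊆ zs))
⊆-++⁻ [] zs {u} p = [] , u , refl , [] , p
⊆-++⁻ (x ∷ xs) zs (_ ∷ʳ p) with ⊆-++⁻ xs zs p
... | u₁ , u₂ , e , q₁ , q₂ = u₁ , u₂ , e , x ∷ʳ q₁ , q₂
⊆-++⁻ (x ∷ xs) zs (refl ∷ p) with ⊆-++⁻ xs zs p
... | u₁ , u₂ , e , q₁ , q₂ = x ∷ u₁ , u₂ , cong (x ∷_) e , refl ∷ q₁ , q₂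

Unique-⊆ : ∀ {u w : List ℕ} → u ⊆ w → Unique w → Unique u
Unique-⊆ [] _ = []
Unique-⊆ (_ ∷ʳ p) (_ ∷ u) = Unique-⊆ p u
Unique-⊆ (refl ∷ p) (x∉ ∷ u) = All.tabulate (λ q → All.lookup x∉ (lookup p q)) ∷ Unique-⊆ p u

pattern132 : Word
pattern132 = 1 ∷ 3 ∷ 2 ∷ []

Avoids132 : Word → Set
Avoids132 σ = ∀ {x y z} → (x ∷ y ∷ z ∷ []) ⊆ σ → x < z → z < y → ⊥

Avoids132-⊆ : ∀ {u w} → u ⊆ w → Avoids132 w → Avoids132 u
Avoids132-⊆ s av p = av (⊆-trans p s)

orderIso132-false : ∀ x y z → x ≢ y → y ≢ z → x ≢ z → ¬ (x < z × z < y) → orderIso pattern132 (x ∷ y ∷ z ∷ []) ≡ false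
orderIso132-false x y z x≢y y≢z x≢z ¬132 with <-cmp x y | <-cmp y z | <-cmp x z
... | tri≈ _ e _ | _ | _ = ⊥-elim (x≢y e)
... | _ | tri≈ _ e _ | _ = ⊥-elim (y≢z e)
... | _ | _ | tri≈ _ e _ = ⊥-elim (x≢z e)
... | tri< x<y _ _ | tri< y<z _ _ | tri> _ _ z<x = ⊥-elim (<-asym (<-trans x<y y<z) z<x)
... | tri< _ _ _ | tri> _ _ z<y | tri< x<z _ _ = ⊥-elim (¬132 (x<z , z<y))
... | tri> _ _ y<x | tri> _ _ z<y | tri< x<z _ _ = ⊥-elim (<-asym (<-trans z<y y<x) x<z)
... | tri< x<y _ _ | tri< y<z _ _ | tri< x<z _ _
  rewrite <ᵇ-false {x} {x} ≤-refl | <ᵇ-false {y} {y} ≤-refl | <ᵇ-true x<y | <ᵇ-true x<z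
        | <ᵇ-false {y} {x} (<⇒≤ x<y) | <ᵇ-true y<z = refl
... | tri< x<y _ _ | tri> _ _ z<y | tri> _ _ z<x
  rewrite <ᵇ-false {x} {x} ≤-refl | <ᵇ-true x<y | <ᵇ-false {x} {z} (<⇒≤ z<x) = refl
... | tri> _ _ y<x | tri< y<z _ _ | tri< x<z _ _
  rewrite <ᵇ-false {x} {x} ≤-refl | <ᵇ-false {x} {y} (<⇒≤ y<x) = refl
... | tri> _ _ y<x | tri< y<z _ _ | tri> _ _ z<x
  rewrite <ᵇ-false {x} {x} ≤-refl | <ᵇ-false {x} {y} (<⇒≤ y<x) = refl
... | tri> _ _ y<x | tri> _ _ z<y | tri> _ _ z<x
  rewrite <ᵇ-false {x} {x} ≤-refl | <ᵇ-false {x} {y} (<⇒≤ y<x) = refl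

orderIso132⁺ : ∀ x y z → x < z → z < y → orderIso pattern132 (x ∷ y ∷ z ∷ []) ≡ true
orderIso132⁺ x y z xz zy
  rewrite <ᵇ-false {x} {x} ≤-refl | <ᵇ-false {y} {y} ≤-refl | <ᵇ-false {z} {z} ≤-refl
        | <ᵇ-true {x} {y} (<-trans xz zy) | <ᵇ-true xz | <ᵇ-true zy
        | <ᵇ-false {y} {x} (<⇒≤ (<-trans xz zy)) | <ᵇ-false {z} {x} (<⇒≤ xz) | <ᵇ-false {y} {z} (<⇒≤ zy) = refl

Avoids132⇒avoids : ∀ σ → Unique σ → Avoids132 σ → avoids pattern132 σ ≡ true
Avoids132⇒avoids σ u av = cong not (any-false⁺ _ (subseqs 3 σ) noOccurrence)
  where
  noOccurrence : ∀ {w} → w ∈ subseqs 3 σ → orderIso pattern132 w ≡ false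
  noOccurrence {w} q with ∈-subseqs⁻ 3 σ q
  ... | s , l with w | l
  ... | x ∷ y ∷ z ∷ [] | refl with Unique-⊆ s u
  ... | x∉ ∷ y∉ ∷ _ ∷ [] = orderIso132-false x y z (All.lookup x∉ (here refl)) (All.lookup y∉ (here refl))
          (All.lookup x∉ (there (here refl))) (λ { (x<z , z<y) → av s x<z z<y })

avoids⇒Avoids132 : ∀ σ → avoids pattern132 σ ≡ true → Avoids132 σ
avoids⇒Avoids132 σ e p x<z z<y =
  true≢false (trans (sym e) (cong not (any-true⁺ _ (subseqs 3 σ) (∈-subseqs⁺ p) (orderIso132⁺ _ _ _ x<z z<y))))

-- The permutation of a tree avoids 132: an occurrence cannot straddle the
-- maximum, since every left entry exceeds every right entry.
perm-Avoids132 : ∀ lo t → Avoids132 (perm lo t)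
perm-Avoids132 lo leaf ()
perm-Avoids132 lo (node a b) {x} {y} {z} p x<z z<y
  with ⊆-++⁻ (perm (lo + size b) a) ((lo + size (node a b)) ∷ perm lo b) p
... | [] , _ , refl , _ , _ ∷ʳ q₂ = perm-Avoids132 lo b q₂ x<z z<y
... | [] , _ , refl , _ , refl ∷ q₂ = <-asym (<-trans x<z z<y) (perm-right<root lo a b (lookup q₂ (here refl)))
... | (_ ∷ []) , _ , refl , q₁ , q₂ =
  <-asym x<z (≤-<-trans (proj₂ (perm-within lo b (z∈ q₂))) (proj₁ (perm-within _ a (lookup q₁ (here refl)))))
  where
  z∈ : ∀ {m ys} → (y ∷ z ∷ []) ⊆ (m ∷ ys) → z ∈ ys
  z∈ (_ ∷ʳ q) = lookup q (there (here refl))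
  z∈ (refl ∷ q) = lookup q (here refl)
... | (_ ∷ _ ∷ []) , _ , refl , q₁ , _ ∷ʳ q₂ =
  <-asym x<z (≤-<-trans (proj₂ (perm-within lo b (lookup q₂ (here refl)))) (proj₁ (perm-within _ a (lookup q₁ (here refl)))))
... | (_ ∷ _ ∷ []) , _ , refl , q₁ , refl ∷ q₂ = <-asym z<y (perm-left<root lo a b (lookup q₁ (there (here refl))))
... | (_ ∷ _ ∷ _ ∷ []) , [] , refl , q₁ , _ = perm-Avoids132 (lo + size b) a q₁ x<z z<y

-- Every 132-avoiding permutation of an interval is perm of a tree.
-- We split it at its maximum m:  σ = xs ++ m ∷ ys.

unique-++⁻ : ∀ (xs : List ℕ) {zs : List ℕ} → Unique (xs ++ zs) →
  Unique xs × Unique zs × (∀ {v} → v ∈ xs → v ∈ zs → ⊥)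
unique-++⁻ [] u = [] , u , (λ ())
unique-++⁻ (x ∷ xs) {zs} (x∉ ∷ u) with unique-++⁻ xs u
... | uxs , uzs , disjoint = All.tabulate (λ q → All.lookup x∉ (∈-++⁺ˡ q)) ∷ uxs , uzs , disjoint′
  where
  disjoint′ : ∀ {v} → v ∈ x ∷ xs → v ∈ zs → ⊥
  disjoint′ (here refl) q = All.lookup x∉ (∈-++⁺ʳ xs q) refl
  disjoint′ (there p) q = disjoint p q

left-above-right : ∀ xs m ys → Unique (xs ++ m ∷ ys) → Avoids132 (xs ++ m ∷ ys) →
  (∀ {y} → y ∈ ys → y < m) → ∀ {x y} → x ∈ xs → y ∈ ys → y < x
left-above-right xs m ys u av y<m {x} {y} p q with <-cmp x y
... | tri< x<y _ _ = ⊥-elim (av (++⁺ (from∈ p) (refl ∷ from∈ q)) x<y (y<m q))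
... | tri≈ _ refl _ = ⊥-elim (proj₂ (proj₂ (unique-++⁻ xs u)) p (there q))
... | tri> _ _ y<x = y<x

-- If all of (lo, lo + |ys|] occurs in xs ++ m ∷ ys, with m above that interval
-- and xs above ys, then ys stays below lo + |ys|: otherwise ys would contain
-- that interval and one more value.
after-max-within : ∀ lo xs m ys → Unique ys → (∀ {y} → y ∈ ys → lo < y) →
  (∀ {v} → lo < v → v ≤ lo + length ys → v ∈ xs ++ m ∷ ys) → lo + length ys < m →
  (∀ {x y} → x ∈ xs → y ∈ ys → y < x) → Within lo (lo + length ys) ys
after-max-within lo xs m ys u lo<y full m-above xs-above {y} q with y ≤? lo + length ys
... | yes y≤ = lo<y q , y≤
... | no y≰ = ⊥-elim (<-irrefl refl (subst (λ k → suc k ≤ B) (interval-length lo B) tooMany))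
  where
  B : ℕ
  B = length ys
  v<y : ∀ {v} → v ∈ interval lo B → v < y
  v<y r = ≤-<-trans (proj₂ (interval-within lo B r)) (≰⇒> y≰)
  interval⊆ys : ∀ {v} → v ∈ y ∷ interval lo B → v ∈ ys
  interval⊆ys (here refl) = q
  interval⊆ys (there r) with ∈-++⁻ xs (full (proj₁ (interval-within lo B r)) (proj₂ (interval-within lo B r)))
  ... | inj₁ p = ⊥-elim (<-asym (xs-above p q) (v<y r))
  ... | inj₂ (here e) = ⊥-elim (<-irrefl e (≤-<-trans (proj₂ (interval-within lo B r)) m-above))
  ... | inj₂ (there p) = p
  tooMany : suc (length (interval lo B)) ≤ B
  tooMany = length-≤-subset (y ∷ interval lo B) ys
    (All.tabulate (λ r e → <-irrefl (sym e) (v<y r)) ∷ perm-unique lo (comb B)) interval⊆ys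

before-max-within : ∀ lo xs m ys → (∀ {v} → v ∈ xs → v ∈ m ∷ ys → ⊥) → (∀ {x} → x ∈ xs → lo < x × x < m) →
  m ≡ lo + (length xs + suc (length ys)) → (∀ {v} → lo < v → v ≤ lo + length ys → v ∈ ys) →
  Within (lo + length ys) (lo + length ys + length xs) xs
before-max-within lo xs m ys disjoint bounds refl ys-full {x} p with x ≤? lo + length ys
... | yes x≤ = ⊥-elim (disjoint p (there (ys-full (proj₁ (bounds p)) x≤)))
... | no x≰ = ≰⇒> x≰ , ≤-pred (subst (x <_) (top-value lo (length xs) (length ys)) (proj₂ (bounds p)))
  where
  top-value : ∀ lo A B → lo + (A + suc B) ≡ suc (lo + B + A)
  top-value = solve-∀

max-split : ∀ lo s xs ys → let σ = xs ++ (lo + suc s) ∷ ys in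
  Unique σ → Within lo (lo + suc s) σ → length σ ≡ suc s → Avoids132 σ →
  length xs + length ys ≡ s × Unique xs × Unique ys ×
  Within (lo + length ys) (lo + length ys + length xs) xs × Within lo (lo + length ys) ys
max-split lo s xs ys u w len av = A+B≡s , proj₁ uσ , uys , wxs , wys
  where
  m : ℕ
  m = lo + suc s
  A : ℕ
  A = length xs
  B : ℕ
  B = length ys
  A+suc[B]≡suc[s] : A + suc B ≡ suc s
  A+suc[B]≡suc[s] = trans (sym (length-++ xs)) len
  A+B≡s : A + B ≡ s
  A+B≡s = suc-injective (trans (sym (+-suc A B)) A+suc[B]≡suc[s])
  B≤s : B ≤ s
  B≤s = subst (B ≤_) A+B≡s (m≤n+m B A)
  uσ : Unique xs × Unique ((lo + suc s) ∷ ys) × (∀ {v} → v ∈ xs → v ∈ (lo + suc s) ∷ ys → ⊥)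
  uσ = unique-++⁻ xs u
  uys : Unique ys
  uys with proj₁ (proj₂ uσ)
  ... | _ ∷ u′ = u′
  ys∌m : m ∉ ys
  ys∌m with proj₁ (proj₂ uσ)
  ... | m∉ ∷ _ = λ q → All.lookup m∉ q refl
  y<m : ∀ {y} → y ∈ ys → y < m
  y<m q = ≤∧≢⇒< (proj₂ (w (∈-++⁺ʳ xs (there q)))) (λ { refl → ys∌m q })
  wys : Within lo (lo + B) ys
  wys = after-max-within lo xs m ys uys (λ q → proj₁ (w (∈-++⁺ʳ xs (there q))))
    (λ l h → Within-full lo (suc s) _ u w len l (≤-trans h (+-monoʳ-≤ lo (≤-trans B≤s (n≤1+n s)))))
    (+-monoʳ-< lo (s≤s B≤s)) (left-above-right xs m ys u av y<m)
  x-bounds : ∀ {x} → x ∈ xs → lo < x × x < m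
  x-bounds p = proj₁ (w (∈-++⁺ˡ p)) , ≤∧≢⇒< (proj₂ (w (∈-++⁺ˡ p))) (λ { refl → proj₂ (proj₂ uσ) p (here refl) })
  wxs : Within (lo + B) (lo + B + A) xs
  wxs = before-max-within lo xs m ys (proj₂ (proj₂ uσ)) x-bounds (cong (lo +_) (sym A+suc[B]≡suc[s]))
    (Within-full lo B ys uys wys refl)

-- Every duplicate-free 132-avoider of length s with values in (lo, lo + s] is
-- perm lo t for a tree t of size s (n is fuel bounding s).
avoider⇒perm : ∀ n s lo σ → s ≤ n → Unique σ → Within lo (lo + s) σ → length σ ≡ s → Avoids132 σ →
  Σ Tree (λ t → size t ≡ s × perm lo t ≡ σ)
avoider⇒perm n zero lo [] _ _ _ _ _ = leaf , refl , refl
avoider⇒perm (suc n) (suc s) lo σ (s≤s s≤n) u w len av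
  with ∈-∃++ (Within-full lo (suc s) σ u w len (subst (lo <_) (sym (+-suc lo s)) (s≤s (m≤m+n lo s))) ≤-refl)
... | xs , ys , refl with max-split lo s xs ys u w len av
... | A+B≡s , uxs , uys , wxs , wys
  with avoider⇒perm n _ _ xs (≤-trans (subst (length xs ≤_) A+B≡s (m≤m+n _ _)) s≤n) uxs wxs refl
         (Avoids132-⊆ (++⁺ʳ _ ⊆-refl) av)
     | avoider⇒perm n _ lo ys (≤-trans (subst (length ys ≤_) A+B≡s (m≤n+m _ _)) s≤n) uys wys refl
         (Avoids132-⊆ (++⁺ˡ xs (_ ∷ʳ ⊆-refl)) av)
... | ta , sa , ea | tb , sb , eb = node ta tb , size≡ , perm≡
  where
  size≡ : suc (size ta + size tb) ≡ suc s
  size≡ rewrite sa | sb = cong suc A+B≡s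
  perm≡ : perm lo (node ta tb) ≡ xs ++ (lo + suc s) ∷ ys
  perm≡ rewrite size≡ | sb | ea | eb = refl

++-∷-injective : ∀ (m : ℕ) xs ys xs′ ys′ → m ∉ xs → m ∉ xs′ → xs ++ m ∷ ys ≡ xs′ ++ m ∷ ys′ → xs ≡ xs′ × ys ≡ ys′
++-∷-injective m [] ys [] ys′ _ _ e = refl , ∷-injectiveʳ e
++-∷-injective m [] ys (x′ ∷ xs′) ys′ _ m∉′ e = ⊥-elim (m∉′ (here (proj₁ (∷-injective e))))
++-∷-injective m (x ∷ xs) ys [] ys′ m∉ _ e = ⊥-elim (m∉ (here (sym (proj₁ (∷-injective e)))))
++-∷-injective m (x ∷ xs) ys (x′ ∷ xs′) ys′ m∉ m∉′ e with ∷-injective e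
... | refl , e′ with ++-∷-injective m xs ys xs′ ys′ (λ q → m∉ (there q)) (λ q → m∉′ (there q)) e′
... | refl , refl = refl , refl

-- A tree is determined by its permutation: cut at the maximum and recurse.
perm-injective : ∀ lo t t′ → perm lo t ≡ perm lo t′ → t ≡ t′
perm-injective lo leaf leaf _ = refl
perm-injective lo leaf (node a b) e = ⊥-elim (0≢1+n (trans (cong length e) (perm-length lo (node a b))))
perm-injective lo (node a b) leaf e = ⊥-elim (0≢1+n (trans (cong length (sym e)) (perm-length lo (node a b))))
perm-injective lo (node a b) (node a′ b′) e
  with trans (sym (perm-length lo (node a b))) (trans (cong length e) (perm-length lo (node a′ b′)))
... | same-size
  with ++-∷-injective (lo + size (node a b)) (perm (lo + size b) a) (perm lo b) (perm (lo + size b′) a′) (perm lo b′)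
         (λ q → <-irrefl refl (perm-left<root lo a b q))
         (λ q → <-irrefl (cong (lo +_) same-size) (perm-left<root lo a′ b′ q))
         (subst (λ m → perm lo (node a b) ≡ perm (lo + size b′) a′ ++ m ∷ perm lo b′) (cong (lo +_) (sym same-size)) e)
... | left≡ , right≡ with perm-injective lo b b′ right≡
... | refl = cong (λ a″ → node a″ b) (perm-injective (lo + size b) a a′ left≡)

restrict-++ : ∀ k xs ys → restrict k (xs ++ ys) ≡ restrict k xs ++ restrict k ys
restrict-++ k [] ys = refl
restrict-++ k (x ∷ xs) ys with x <ᵇ suc k
... | true = cong (x ∷_) (restrict-++ k xs ys)
... | false = restrict-++ k xs ys

restrict-all : ∀ k xs → (∀ {v} → v ∈ xs → v ≤ k) → restrict k xs ≡ xs
restrict-all k [] h = refl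
restrict-all k (x ∷ xs) h rewrite <ᵇ-true {x} {suc k} (s≤s (h (here refl))) = cong (x ∷_) (restrict-all k xs (λ p → h (there p)))

restrict-none : ∀ k xs → (∀ {v} → v ∈ xs → k < v) → restrict k xs ≡ []
restrict-none k [] h = refl
restrict-none k (x ∷ xs) h rewrite <ᵇ-false {x} {suc k} (h (here refl)) = restrict-none k xs (λ p → h (there p))

restrict-node : ∀ k lo a b → k < lo + size (node a b) →
  restrict k (perm lo (node a b)) ≡ restrict k (perm (lo + size b) a) ++ restrict k (perm lo b)
restrict-node k lo a b k<root rewrite restrict-++ k (perm (lo + size b) a) ((lo + size (node a b)) ∷ perm lo b)
  | <ᵇ-false {lo + size (node a b)} {suc k} k<root = refl

restrict-perm : ∀ k lo t → Σ Tree (λ r → r ≼ t × restrict k (perm lo t) ≡ perm lo r)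
restrict-perm k lo leaf = leaf , self , refl
restrict-perm k lo (node a b) with lo + size (node a b) ≤? k
... | yes root≤k = node a b , self , restrict-all k _ (λ q → ≤-trans (proj₂ (perm-within lo (node a b) q)) root≤k)
... | no root≰k with lo + size b ≤? k
... | yes b≤k with restrict-perm k (lo + size b) a
... | r , r≼a , eq = skew r b , left r≼a , (begin
      restrict k (perm lo (node a b))
        ≡⟨ restrict-node k lo a b (≰⇒> root≰k) ⟩
      restrict k (perm (lo + size b) a) ++ restrict k (perm lo b)
        ≡⟨ cong₂ _++_ eq (restrict-all k (perm lo b) (λ w → ≤-trans (proj₂ (perm-within lo b w)) b≤k)) ⟩
      perm (lo + size b) r ++ perm lo b
        ≡⟨ sym (perm-skew lo r b) ⟩
      perm lo (skew r b) ∎)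
restrict-perm k lo (node a b) | no root≰k | no b≰k with restrict-perm k lo b
... | r , r≼b , eq = r , right r≼b , (begin
      restrict k (perm lo (node a b))
        ≡⟨ restrict-node k lo a b (≰⇒> root≰k) ⟩
      restrict k (perm (lo + size b) a) ++ restrict k (perm lo b)
        ≡⟨ cong₂ _++_ (restrict-none k _ (λ w → <-trans (≰⇒> b≰k) (proj₁ (perm-within _ a w)))) eq ⟩
      perm lo r ∎)

restriction-perm : ∀ {r t} lo → r ≼ t → Σ ℕ (λ k → lo ≤ k × k ≤ lo + size t × restrict k (perm lo t) ≡ perm lo r)
restriction-perm {r} {t} lo self = lo + size t , m≤m+n lo _ , ≤-refl , restrict-all _ _ (λ q → proj₂ (perm-within lo t q))
restriction-perm {r} {node a b} lo (right p) with restriction-perm lo p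
... | k , lo≤k , k≤ , eq = k , lo≤k , ≤-trans k≤ (+-monoʳ-≤ lo (≤-trans (m≤n+m (size b) (size a)) (n≤1+n _))) , (begin
      restrict k (perm lo (node a b))
        ≡⟨ restrict-node k lo a b (≤-<-trans k≤ (≤-<-trans (m≤m+n _ (size a)) (root-above-left lo a b))) ⟩
      restrict k (perm (lo + size b) a) ++ restrict k (perm lo b)
        ≡⟨ cong (_++ restrict k (perm lo b)) (restrict-none k _ (λ w → ≤-<-trans k≤ (proj₁ (perm-within _ a w)))) ⟩
      restrict k (perm lo b)
        ≡⟨ eq ⟩
      perm lo r ∎)
restriction-perm {_} {node a b} lo (left {r} p) with restriction-perm (lo + size b) p
... | k , b≤k , k≤ , eq = k , ≤-trans (m≤m+n lo (size b)) b≤k , ≤-trans k≤ (<⇒≤ (root-above-left lo a b)) , (begin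
      restrict k (perm lo (node a b))
        ≡⟨ restrict-node k lo a b (≤-<-trans k≤ (root-above-left lo a b)) ⟩
      restrict k (perm (lo + size b) a) ++ restrict k (perm lo b)
        ≡⟨ cong₂ _++_ eq (restrict-all k (perm lo b) (λ w → ≤-trans (proj₂ (perm-within lo b w)) b≤k)) ⟩
      perm (lo + size b) r ++ perm lo b
        ≡⟨ sym (perm-skew lo r b) ⟩
      perm lo (skew r b) ∎)

descent3 : ℕ → ℕ → List ℕ → Bool
descent3 a b [] = false
descent3 a b (c ∷ _) = (b <ᵇ a) ∧ (c <ᵇ b)

hasDD-∷ : ∀ a b w → hasDoubleDescent (a ∷ b ∷ w) ≡ descent3 a b w ∨ hasDoubleDescent (b ∷ w)
hasDD-∷ a b [] = refl
hasDD-∷ a b (c ∷ r) = refl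

startsDescW : List ℕ → Bool
startsDescW (a ∷ b ∷ _) = b <ᵇ a
startsDescW _ = false

descent3-++ : ∀ x₁ x₂ m ys rest → x₂ ≤ m → descent3 x₁ x₂ (rest ++ m ∷ ys) ≡ descent3 x₁ x₂ rest
descent3-++ x₁ x₂ m ys [] x₂≤m rewrite <ᵇ-false {m} {x₂} x₂≤m = ∧-zeroʳ _
descent3-++ x₁ x₂ m ys (c ∷ _) _ = refl

hasDD-below-max : ∀ xs m ys → (∀ {v} → v ∈ xs → v < m) →
  hasDoubleDescent (xs ++ m ∷ ys) ≡ hasDoubleDescent xs ∨ hasDoubleDescent (m ∷ ys)
hasDD-below-max [] m ys h = refl
hasDD-below-max (x ∷ []) m ys h rewrite hasDD-∷ x m ys = cong (_∨ hasDoubleDescent (m ∷ ys)) (ascent ys)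
  where
  ascent : ∀ ys → descent3 x m ys ≡ false
  ascent [] = refl
  ascent (c ∷ _) rewrite <ᵇ-false {m} {x} (<⇒≤ (h (here refl))) = refl
hasDD-below-max (x₁ ∷ x₂ ∷ rest) m ys h = begin
  hasDoubleDescent (x₁ ∷ x₂ ∷ rest ++ m ∷ ys)
    ≡⟨ hasDD-∷ x₁ x₂ (rest ++ m ∷ ys) ⟩
  descent3 x₁ x₂ (rest ++ m ∷ ys) ∨ hasDoubleDescent (x₂ ∷ rest ++ m ∷ ys)
    ≡⟨ cong₂ _∨_ (descent3-++ x₁ x₂ m ys rest (<⇒≤ (h (there (here refl)))))
                 (hasDD-below-max (x₂ ∷ rest) m ys (λ p → h (there p))) ⟩
  descent3 x₁ x₂ rest ∨ (hasDoubleDescent (x₂ ∷ rest) ∨ hasDoubleDescent (m ∷ ys))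
    ≡⟨ sym (∨-assoc (descent3 x₁ x₂ rest) _ _) ⟩
  (descent3 x₁ x₂ rest ∨ hasDoubleDescent (x₂ ∷ rest)) ∨ hasDoubleDescent (m ∷ ys)
    ≡⟨ cong (_∨ hasDoubleDescent (m ∷ ys)) (sym (hasDD-∷ x₁ x₂ rest)) ⟩
  hasDoubleDescent (x₁ ∷ x₂ ∷ rest) ∨ hasDoubleDescent (m ∷ ys) ∎

hasDD-max∷ : ∀ m ys → (∀ {v} → v ∈ ys → v < m) → hasDoubleDescent (m ∷ ys) ≡ startsDescW ys ∨ hasDoubleDescent ys
hasDD-max∷ m [] h = refl
hasDD-max∷ m (y ∷ []) h = refl
hasDD-max∷ m (y₁ ∷ y₂ ∷ r) h rewrite <ᵇ-true {y₁} {m} (h (here refl)) = refl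

startsDescW-below-max : ∀ xs m ys → 0 < length xs → (∀ {v} → v ∈ xs → v < m) → startsDescW (xs ++ m ∷ ys) ≡ startsDescW xs
startsDescW-below-max (x ∷ []) m ys _ h = <ᵇ-false {m} {x} (<⇒≤ (h (here refl)))
startsDescW-below-max (x₁ ∷ x₂ ∷ r) m ys _ h = refl

perm-startsDesc : ∀ lo t → startsDescW (perm lo t) ≡ startsDesc t
perm-startsDesc lo leaf = refl
perm-startsDesc lo (node leaf leaf) = refl
perm-startsDesc lo (node leaf (node p q)) with perm lo (node p q) in eq
... | [] = ⊥-elim (0≢1+n (trans (cong length (sym eq)) (perm-length lo (node p q))))
... | y ∷ r = <ᵇ-true (perm-right<root lo leaf (node p q) (subst (y ∈_) (sym eq) (here refl)))
perm-startsDesc lo (node (node x y) b) = trans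
  (startsDescW-below-max (perm (lo + size b) (node x y)) _ (perm lo b)
     (subst (0 <_) (sym (perm-length _ (node x y))) (s≤s z≤n)) (perm-left<root lo (node x y) b))
  (perm-startsDesc (lo + size b) (node x y))

perm-hasDD : ∀ lo t → hasDoubleDescent (perm lo t) ≡ hasDD t
perm-hasDD lo leaf = refl
perm-hasDD lo (node a b)
  rewrite hasDD-below-max (perm (lo + size b) a) (lo + size (node a b)) (perm lo b) (perm-left<root lo a b)
        | hasDD-max∷ (lo + size (node a b)) (perm lo b) (perm-right<root lo a b)
        | perm-hasDD (lo + size b) a | perm-hasDD lo b | perm-startsDesc lo b
  = cong (hasDD a ∨_) (∨-comm (startsDesc b) (hasDD b))

-- perm t is simsun (in the sense of Defs) iff t is Simsun: the restrictions of
-- perm t are the permutations of the restriction trees.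

∈[1…]⁺ : ∀ {k n} → 0 < k → k ≤ n → k ∈ [1… n ]
∈[1…]⁺ {suc k} {n} _ k≤n = ∈-applyUpTo⁺ suc k≤n

isSimsun⇒Simsun : ∀ t → isSimsun (size t) (perm 0 t) ≡ true → Simsun t
isSimsun⇒Simsun t e r r≼t with restriction-perm 0 r≼t
... | zero , _ , _ , eq = trans (sym (perm-hasDD 0 r))
      (cong hasDoubleDescent (trans (sym eq) (restrict-none 0 (perm 0 t) (λ w → proj₁ (perm-within 0 t w)))))
... | suc k , _ , k≤ , eq = trans (sym (perm-hasDD 0 r)) (trans (cong hasDoubleDescent (sym eq))
      (not-true _ (all-true⁻ (λ k → not (hasDoubleDescent (restrict k (perm 0 t)))) [1… size t ] e (∈[1…]⁺ (s≤s z≤n) k≤))))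

Simsun⇒isSimsun : ∀ t n → Simsun t → isSimsun n (perm 0 t) ≡ true
Simsun⇒isSimsun t n sim = all-true⁺ _ [1… n ] (λ {k} _ → let (r , r≼t , eq) = restrict-perm k 0 t in
  cong not (trans (cong hasDoubleDescent eq) (trans (perm-hasDD 0 r) (sim r r≼t))))

-- Its one-line notation lists the positions of the
-- values 1, 2, … ; for perm 0 (node a b) these are the positions of the values
-- of b (shifted past a and the root), then those of a, then the root's.

position-++-∉ : ∀ k xs ys → k ∉ xs → position k (xs ++ ys) ≡ length xs + position k ys
position-++-∉ k [] ys _ = refl
position-++-∉ k (x ∷ xs) ys h rewrite ≡ᵇ-false {k} {x} (λ e → h (here e)) = cong suc (position-++-∉ k xs ys (λ q → h (there q)))

position-++-∈ : ∀ k xs ys → k ∈ xs → position k (xs ++ ys) ≡ position k xs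
position-++-∈ k (x ∷ xs) ys p with k ≡ᵇ x in eq
... | true = refl
position-++-∈ k (x ∷ xs) ys (here e) | false = ⊥-elim (true≢false (trans (sym (subst (λ z → (k ≡ᵇ z) ≡ true) e (≡ᵇ-refl k))) eq))
position-++-∈ k (x ∷ xs) ys (there p) | false = cong suc (position-++-∈ k xs ys p)

≡ᵇ-shift : ∀ c k x → (c + k ≡ᵇ c + x) ≡ (k ≡ᵇ x)
≡ᵇ-shift zero k x = refl
≡ᵇ-shift (suc c) k x = ≡ᵇ-shift c k x

position-shift : ∀ c k xs → position (c + k) (map (c +_) xs) ≡ position k xs
position-shift c k [] = refl
position-shift c k (x ∷ xs) rewrite ≡ᵇ-shift c k x | position-shift c k xs = refl

applyUpTo-++ : ∀ (f : ℕ → ℕ) m n → applyUpTo f (m + n) ≡ applyUpTo f m ++ applyUpTo (λ i → f (m + i)) n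
applyUpTo-++ f zero n = refl
applyUpTo-++ f (suc m) n = cong (f 0 ∷_) (applyUpTo-++ (λ i → f (suc i)) m n)

applyUpTo-cong : ∀ (f g : ℕ → ℕ) n → (∀ i → i < n → f i ≡ g i) → applyUpTo f n ≡ applyUpTo g n
applyUpTo-cong f g zero h = refl
applyUpTo-cong f g (suc n) h = cong₂ _∷_ (h 0 (s≤s z≤n)) (applyUpTo-cong (λ i → f (suc i)) (λ i → g (suc i)) n (λ i p → h (suc i) (s≤s p)))

size-star : ∀ t → size (star t) ≡ size t
size-star leaf = refl
size-star (node a b) rewrite size-skew (star b) (node (star a) leaf) | size-star a | size-star b = size-eq (size a) (size b)
  where
  size-eq : ∀ A B → B + suc (A + 0) ≡ suc (A + B)
  size-eq = solve-∀

positions : List ℕ → ℕ → List ℕ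
positions σ n = applyUpTo (λ i → position (suc i) σ) n

module _ (a b : Tree) where
  private
    A : ℕ
    A = size a
    B : ℕ
    B = size b
    σ : List ℕ
    σ = perm 0 (node a b)

  -- A value i+1 ≤ B sits in the right part, after the A letters of a and the root.
  position-right : ∀ i → i < B → position (suc i) σ ≡ suc A + position (suc i) (perm 0 b)
  position-right i i<B = begin
    position (suc i) σ
      ≡⟨ position-++-∉ (suc i) (perm B a) _ (λ q → <-irrefl refl (≤-trans (proj₁ (perm-within B a q)) i<B)) ⟩
    length (perm B a) + position (suc i) (suc (A + B) ∷ perm 0 b)
      ≡⟨ cong₂ _+_ (perm-length B a) (not-root (≡ᵇ-false (λ e → <-irrefl e (≤-<-trans i<B (≤-<-trans (m≤n+m B A) (n<1+n _)))))) ⟩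
    A + suc (position (suc i) (perm 0 b))
      ≡⟨ +-suc A _ ⟩
    suc A + position (suc i) (perm 0 b) ∎
    where
    not-root : (suc i ≡ᵇ suc (A + B)) ≡ false →
      position (suc i) (suc (A + B) ∷ perm 0 b) ≡ suc (position (suc i) (perm 0 b))
    not-root e rewrite e = refl

  position-left : ∀ i → i < A → position (suc (B + i)) σ ≡ position (suc i) (perm 0 a)
  position-left i i<A = begin
    position (suc (B + i)) σ
      ≡⟨ position-++-∈ (suc (B + i)) (perm B a) _
           (perm-complete B a (suc (B + i)) (s≤s (m≤m+n B i)) (subst (_≤ B + A) (+-suc B i) (+-monoʳ-≤ B i<A))) ⟩
    position (suc (B + i)) (perm B a)
      ≡⟨ cong₂ position (sym (+-suc B i)) (perm-shift₀ B a) ⟩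
    position (B + suc i) (map (B +_) (perm 0 a))
      ≡⟨ position-shift B (suc i) (perm 0 a) ⟩
    position (suc i) (perm 0 a) ∎

  position-root : position (suc (B + A)) σ ≡ suc A
  position-root = begin
    position (suc (B + A)) σ
      ≡⟨ cong (λ k → position (suc k) σ) (+-comm B A) ⟩
    position (suc (A + B)) σ
      ≡⟨ position-++-∉ (suc (A + B)) (perm B a) _ (λ q → <-irrefl refl (perm-left<root 0 a b q)) ⟩
    length (perm B a) + position (suc (A + B)) (suc (A + B) ∷ perm 0 b)
      ≡⟨ cong₂ _+_ (perm-length B a) (cong (λ e → if e then 1 else suc (position (suc (A + B)) (perm 0 b))) (≡ᵇ-refl (suc (A + B)))) ⟩
    A + 1
      ≡⟨ +-comm A 1 ⟩
    suc A ∎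

  perm-star-node : perm 0 (star (node a b)) ≡ perm (suc A) (star b) ++ perm 0 (star a) ++ suc A ∷ []
  perm-star-node rewrite perm-skew 0 (star b) (node (star a) leaf) | size-star a | +-identityʳ A = refl

positions-perm : ∀ t → positions (perm 0 t) (size t) ≡ perm 0 (star t)
positions-perm leaf = refl
positions-perm (node a b) = begin
  applyUpTo f (suc (A + B))
    ≡⟨ cong (λ n → applyUpTo f (suc n)) (+-comm A B) ⟩
  applyUpTo f (suc (B + A))
    ≡⟨ sym (applyUpTo-∷ʳ f (B + A)) ⟩
  applyUpTo f (B + A) ++ f (B + A) ∷ []
    ≡⟨ cong (_++ f (B + A) ∷ []) (applyUpTo-++ f B A) ⟩
  (applyUpTo f B ++ applyUpTo (λ i → f (B + i)) A) ++ f (B + A) ∷ []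
    ≡⟨ ++-assoc (applyUpTo f B) _ _ ⟩
  applyUpTo f B ++ applyUpTo (λ i → f (B + i)) A ++ f (B + A) ∷ []
    ≡⟨ cong₂ _++_ right-part (cong₂ _++_ left-part (cong (_∷ []) (position-root a b))) ⟩
  perm (suc A) (star b) ++ perm 0 (star a) ++ suc A ∷ []
    ≡⟨ sym (perm-star-node a b) ⟩
  perm 0 (star (node a b)) ∎
  where
  A : ℕ
  A = size a
  B : ℕ
  B = size b
  f : ℕ → ℕ
  f i = position (suc i) (perm 0 (node a b))
  right-part : applyUpTo f B ≡ perm (suc A) (star b)
  right-part = begin
    applyUpTo f B
      ≡⟨ applyUpTo-cong f _ B (position-right a b) ⟩
    applyUpTo (λ i → suc A + position (suc i) (perm 0 b)) B
      ≡⟨ sym (map-applyUpTo _ (suc A +_) B) ⟩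
    map (suc A +_) (positions (perm 0 b) B)
      ≡⟨ cong (map (suc A +_)) (positions-perm b) ⟩
    map (suc A +_) (perm 0 (star b))
      ≡⟨ sym (perm-shift₀ (suc A) (star b)) ⟩
    perm (suc A) (star b) ∎
  left-part : applyUpTo (λ i → f (B + i)) A ≡ perm 0 (star a)
  left-part = trans (applyUpTo-cong _ _ A (position-left a b)) (positions-perm a)

inverse-perm : ∀ t → inverse (size t) (perm 0 t) ≡ perm 0 (star t)
inverse-perm t = trans (map-applyUpTo suc (λ k → position k (perm 0 t)) (size t)) (positions-perm t)

-- Descents under the skew sum.  perm (skew A B) is perm A placed above perm B,
-- so the junction is a descent; a double descent appears there exactly when
-- A ends or B starts with a descent.  These rules, lifted to all restriction
-- trees, drive the analysis of BiSimsun trees at the root.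

startsDesc-node : ∀ x y → startsDesc (node x y) ≡ false ⟺ ((isNode x ≡ false → isNode y ≡ false) × startsDesc x ≡ false)
startsDesc-node leaf y = (λ p → (λ _ → p) , refl) , (λ p → proj₁ p refl)
startsDesc-node (node p q) y = (λ e → (λ ()) , e) , proj₂

startsDesc-leaf : ∀ t → isNode t ≡ false → startsDesc t ≡ false
startsDesc-leaf leaf _ = refl

endsDesc-node : ∀ x z → endsDesc (node x z) ≡ false ⟺ (isSingleton z ≡ false × endsDesc z ≡ false)
endsDesc-node x leaf = (λ _ → refl , refl) , (λ _ → refl)
endsDesc-node x (node leaf leaf) = (λ ()) , (λ ())
endsDesc-node x (node leaf (node p q)) = (λ e → refl , e) , proj₂
endsDesc-node x (node (node p q) leaf) = (λ e → refl , e) , proj₂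
endsDesc-node x (node (node p q) (node z1 z2)) = (λ e → refl , e) , proj₂

hasDD-node : ∀ a b → hasDD (node a b) ≡ false ⟺ (hasDD a ≡ false × hasDD b ≡ false × startsDesc b ≡ false)
hasDD-node a b = (λ e → let (p , q) = ∨-false⁻ (hasDD a) _ e ; (r , s) = ∨-false⁻ (hasDD b) _ q in p , r , s)
           , (λ { (p , r , s) → ∨-false⁺ p (∨-false⁺ r s) })

-- perm (skew A B) has no double descent.
SkewNoDD : Tree → Tree → Set
SkewNoDD A B = hasDD A ≡ false × hasDD B ≡ false × (isNode A ≡ true → isNode B ≡ true → endsDesc A ≡ false × startsDesc B ≡ false)

hasDD-skew-step : ∀ x y B → startsDesc (skew y B) ≡ startsDesc y → endsDesc (node x y) ≡ endsDesc y → isNode y ≡ true →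
  (hasDD (skew y B) ≡ false ⟺ SkewNoDD y B) → hasDD (node x (skew y B)) ≡ false ⟺ SkewNoDD (node x y) B
hasDD-skew-step x y B fe ee ny IH = to , from
  where
  to : hasDD (node x (skew y B)) ≡ false → SkewNoDD (node x y) B
  to e with proj₁ (hasDD-node x (skew y B)) e
  ... | p1 , q1 , s1 with proj₁ IH q1
  ... | a , b , c = proj₂ (hasDD-node x y) (p1 , a , trans (sym fe) s1) , b , λ _ nb → trans ee (proj₁ (c ny nb)) , proj₂ (c ny nb)
  from : SkewNoDD (node x y) B → hasDD (node x (skew y B)) ≡ false
  from (dA , dB , h) with proj₁ (hasDD-node x y) dA
  ... | p1 , a , s1 = proj₂ (hasDD-node x (skew y B))
      (p1 , proj₂ IH (a , dB , λ _ nb → trans (sym ee) (proj₁ (h refl nb)) , proj₂ (h refl nb)) , trans fe s1)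

hasDD-skew : ∀ A B → hasDD (skew A B) ≡ false ⟺ SkewNoDD A B
hasDD-skew leaf B = (λ e → refl , e , λ ()) , (λ h → proj₁ (proj₂ h))
hasDD-skew (node x leaf) B = to , from
  where
  to : hasDD (node x B) ≡ false → SkewNoDD (node x leaf) B
  to e with proj₁ (hasDD-node x B) e
  ... | p , r , s = proj₂ (hasDD-node x leaf) (p , refl , refl) , r , λ _ _ → refl , s
  from : SkewNoDD (node x leaf) B → hasDD (node x B) ≡ false
  from (dA , r , h) = proj₂ (hasDD-node x B) (proj₁ (proj₁ (hasDD-node x leaf) dA) , r , fb B h)
    where
    fb : ∀ B → (true ≡ true → isNode B ≡ true → false ≡ false × startsDesc B ≡ false) → startsDesc B ≡ false
    fb leaf _ = refl
    fb (node _ _) h = proj₂ (h refl refl)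
hasDD-skew (node x (node leaf leaf)) B = to , from
  where
  to : hasDD (node x (node leaf B)) ≡ false → SkewNoDD (node x (node leaf leaf)) B
  to e with proj₁ (hasDD-node x (node leaf B)) e
  ... | p , q , s = ∨-false⁺ p refl , proj₁ (proj₂ (proj₁ (hasDD-node leaf B) q)) , λ _ nb → ⊥-elim (true≢false (trans (sym nb) s))
  from : SkewNoDD (node x (node leaf leaf)) B → hasDD (node x (node leaf B)) ≡ false
  from (dA , dB , h) = proj₂ (hasDD-node x (node leaf B))
      (proj₁ (proj₁ (hasDD-node x (node leaf leaf)) dA) , proj₂ (hasDD-node leaf B) (refl , dB , startsDesc-leaf B nb) , nb)
    where
    nb′ : ∀ B → (true ≡ true → isNode B ≡ true → true ≡ false × startsDesc B ≡ false) → isNode B ≡ false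
    nb′ leaf _ = refl
    nb′ (node _ _) h = proj₁ (h refl refl)
    nb : isNode B ≡ false
    nb = nb′ B h
hasDD-skew (node x (node leaf (node p q))) B = (λ e → ⊥-elim (true≢false (proj₂ (proj₂ (proj₁ (hasDD-node x (node leaf (node p (skew q B)))) e)))))
  , (λ h → ⊥-elim (true≢false (proj₂ (proj₂ (proj₁ (hasDD-node x (node leaf (node p q))) (proj₁ h))))))
hasDD-skew (node x (node (node p q) z)) B = hasDD-skew-step x (node (node p q) z) B refl refl refl (hasDD-skew (node (node p q) z) B)

skew-node : ∀ X p q → Σ Tree (λ u → Σ Tree (λ v → skew X (node p q) ≡ node u v))
skew-node leaf p q = p , q , refl
skew-node (node a c) p q = a , skew c (node p q) , refl

isSingleton-skew : ∀ y B → isSingleton (skew y B) ≡ false ⟺ ((isNode B ≡ false → isSingleton y ≡ false) × (isNode y ≡ false → isSingleton B ≡ false))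
isSingleton-skew leaf B = (λ e → (λ _ → refl) , (λ _ → e)) , (λ h → proj₂ h refl)
isSingleton-skew (node p q) leaf rewrite skew-leaf q = (λ e → (λ _ → e) , (λ ())) , (λ h → proj₁ h refl)
isSingleton-skew (node leaf leaf) (node u v) = (λ _ → (λ ()) , (λ ())) , (λ _ → refl)
isSingleton-skew (node leaf (node q1 q2)) (node u v) = (λ _ → (λ ()) , (λ ())) , (λ _ → refl)
isSingleton-skew (node (node p1 p2) q) (node u v) with skew-node q u v
... | u′ , v′ , e rewrite e = (λ _ → (λ ()) , (λ ())) , (λ _ → refl)

-- perm (skew A B) does not end with a descent.
SkewNoEnd : Tree → Tree → Set
SkewNoEnd A B = endsDesc B ≡ false × (isNode B ≡ false → endsDesc A ≡ false) × (isNode A ≡ true → isSingleton B ≡ false)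

endsDesc-skew-step : ∀ x y B →
  (endsDesc (skew y B) ≡ false ⟺ SkewNoEnd y B) → endsDesc (node x (skew y B)) ≡ false ⟺ SkewNoEnd (node x y) B
endsDesc-skew-step x y B IH = to , from
  where
  sB : ∀ y → isSingleton (skew y B) ≡ false → (isNode y ≡ true → isSingleton B ≡ false) → isSingleton B ≡ false
  sB leaf s1 _ = s1
  sB (node _ _) _ h = h refl
  to : endsDesc (node x (skew y B)) ≡ false → SkewNoEnd (node x y) B
  to e with proj₁ (endsDesc-node x (skew y B)) e
  ... | s1 , e1 with proj₁ IH e1
  ... | eB , hB , hy = eB , (λ nb → proj₂ (endsDesc-node x y) (proj₁ (proj₁ (isSingleton-skew y B) s1) nb , hB nb)) , (λ _ → sB y s1 hy)
  from : SkewNoEnd (node x y) B → endsDesc (node x (skew y B)) ≡ false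
  from (eB , h1 , h2) = proj₂ (endsDesc-node x (skew y B))
     (proj₂ (isSingleton-skew y B) ((λ nb → proj₁ (proj₁ (endsDesc-node x y) (h1 nb))) , (λ _ → h2 refl))
     , proj₂ IH (eB , (λ nb → proj₂ (proj₁ (endsDesc-node x y) (h1 nb))) , (λ _ → h2 refl)))

endsDesc-skew : ∀ A B → endsDesc (skew A B) ≡ false ⟺ SkewNoEnd A B
endsDesc-skew leaf B = (λ e → e , (λ _ → refl) , (λ ())) , proj₁
endsDesc-skew (node x y) B = endsDesc-skew-step x y B (endsDesc-skew y B)

startsDesc-skew : ∀ A B → startsDesc (skew A B) ≡ false ⟺
  ((isNode A ≡ false → startsDesc B ≡ false) × startsDesc A ≡ false × (isSingleton A ≡ true → isNode B ≡ false))
startsDesc-skew leaf B = (λ e → (λ _ → e) , refl , (λ ())) , (λ h → proj₁ h refl)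
startsDesc-skew (node leaf leaf) B = (λ e → (λ ()) , refl , (λ _ → e)) , (λ h → proj₂ (proj₂ h) refl)
startsDesc-skew (node leaf (node p q)) B = (λ ()) , (λ { (_ , () , _) })
startsDesc-skew (node (node p q) leaf) B = (λ e → (λ ()) , e , (λ ())) , (λ h → proj₁ (proj₂ h))
startsDesc-skew (node (node p q) (node z1 z2)) B = (λ e → (λ ()) , e , (λ ())) , (λ h → proj₁ (proj₂ h))

Simsun-skew : ∀ A B → Simsun (skew A B) ⟺ (Simsun A × Simsun B × (isNode A ≡ true → isNode B ≡ true → NoEndDesc A × startsDesc B ≡ false))
Simsun-skew A B = to , from
  where
  to : Simsun (skew A B) → Simsun A × Simsun B × (isNode A ≡ true → isNode B ≡ true → NoEndDesc A × startsDesc B ≡ false)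
  to S = (λ r p → proj₁ (proj₁ (hasDD-skew r B) (S _ (≼-skewˡ p))))
       , (λ r p → S r (≼-skewʳ A p))
       , (λ nA nB → ndA nB , proj₂ (proj₂ (proj₂ (proj₁ (hasDD-skew A B) (S _ self))) nA nB))
    where
    ndA : isNode B ≡ true → NoEndDesc A
    ndA nB leaf p = refl
    ndA nB (node u v) p = proj₁ (proj₂ (proj₂ (proj₁ (hasDD-skew (node u v) B) (S _ (≼-skewˡ p)))) refl nB)
  from : Simsun A × Simsun B × (isNode A ≡ true → isNode B ≡ true → NoEndDesc A × startsDesc B ≡ false) → Simsun (skew A B)
  from (sA , sB , h) r p with ≼-skew⁻ A B p
  ... | inj₁ q = sB r q
  ... | inj₂ (r′ , q , refl) = proj₂ (hasDD-skew r′ B) (sA r′ q , sB B self ,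
          λ nr nB → proj₁ (h (≼-isNode q nr) nB) r′ q , proj₂ (h (≼-isNode q nr) nB))

NoEndDesc-skew : ∀ A B → NoEndDesc (skew A B) ⟺ (NoEndDesc B × (isNode B ≡ false → NoEndDesc A) × (isNode A ≡ true → isSingleton B ≡ false))
NoEndDesc-skew A B = to , from
  where
  to : NoEndDesc (skew A B) → NoEndDesc B × (isNode B ≡ false → NoEndDesc A) × (isNode A ≡ true → isSingleton B ≡ false)
  to N = (λ r p → N r (≼-skewʳ A p))
       , (λ nb r p → proj₁ (proj₂ (proj₁ (endsDesc-skew r B) (N _ (≼-skewˡ p)))) nb)
       , (λ nA → proj₂ (proj₂ (proj₁ (endsDesc-skew A B) (N _ self))) nA)
  from : NoEndDesc B × (isNode B ≡ false → NoEndDesc A) × (isNode A ≡ true → isSingleton B ≡ false) → NoEndDesc (skew A B)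
  from (nB , h2 , h3) r p with ≼-skew⁻ A B p
  ... | inj₁ q = nB r q
  ... | inj₂ (r′ , q , refl) = proj₂ (endsDesc-skew r′ B) (nB B self , (λ nb → h2 nb r′ q) , (λ nr → h3 (≼-isNode q nr)))

Simsun-node-leaf : ∀ A → Simsun (node A leaf) ⟺ Simsun A
Simsun-node-leaf A = to , from
  where
  to : Simsun (node A leaf) → Simsun A
  to S r p with S _ (left {b = leaf} p)
  ... | e rewrite skew-leaf r = e
  from : Simsun A → Simsun (node A leaf)
  from sA r self = ∨-false⁺ (sA A self) refl
  from sA r (right p) rewrite ≼-leaf p = refl
  from sA _ (left {r} p) rewrite skew-leaf r = sA r p

NoEndDesc-node-leaf : ∀ A → NoEndDesc (node A leaf) ⟺ NoEndDesc A
NoEndDesc-node-leaf A = to , from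
  where
  to : NoEndDesc (node A leaf) → NoEndDesc A
  to S r p with S _ (left {b = leaf} p)
  ... | e rewrite skew-leaf r = e
  from : NoEndDesc A → NoEndDesc (node A leaf)
  from sA r self = refl
  from sA r (right p) rewrite ≼-leaf p = refl
  from sA _ (left {r} p) rewrite skew-leaf r = sA r p

NoEndDesc-leaf : NoEndDesc leaf
NoEndDesc-leaf r p rewrite ≼-leaf p = refl

Simsun-leaf : Simsun leaf
Simsun-leaf r p rewrite ≼-leaf p = refl

star-node : ∀ a b → Σ Tree (λ u → Σ Tree (λ v → star (node a b) ≡ node u v))
star-node a b = skew-node (star b) (star a) leaf

isNode-star : ∀ t → isNode (star t) ≡ isNode t
isNode-star leaf = refl
isNode-star (node a b) with star-node a b
... | u , v , e rewrite e = refl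

isSingleton-star : ∀ t → isSingleton (star t) ≡ isSingleton t
isSingleton-star leaf = refl
isSingleton-star (node leaf leaf) = refl
isSingleton-star (node (node p q) leaf) with star-node p q
... | u , v , e rewrite e = refl
isSingleton-star (node leaf (node p q)) with star-node p q
... | u , v , e rewrite e with skew-node v leaf leaf
... | u′ , v′ , e′ rewrite e′ = refl
isSingleton-star (node (node a1 a2) (node p q)) with star-node p q
... | u , v , e rewrite e with skew-node v (star (node a1 a2)) leaf
... | u′ , v′ , e′ rewrite e′ = refl

startsDesc-node-leaf : ∀ X → startsDesc (node X leaf) ≡ startsDesc X
startsDesc-node-leaf leaf = refl
startsDesc-node-leaf (node p q) = refl

isSingleton-node-leaf : ∀ X → isSingleton (node X leaf) ≡ false ⟺ isNode X ≡ true
isSingleton-node-leaf leaf = (λ ()) , (λ ())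
isSingleton-node-leaf (node p q) = (λ _ → refl) , (λ _ → refl)

-- The trees of DRS permutations: perm t and its inverse perm (star t) are simsun.
BiSimsun : Tree → Set
BiSimsun t = Simsun t × Simsun (star t)

-- The conditions a left subtree a, resp. a nonempty right subtree b, must meet
-- in a BiSimsun tree node a b (BiSimsun-node).
LeftFit : Tree → Set
LeftFit a = NoEndDesc a × startsDesc (star a) ≡ false

RightFit : Tree → Set
RightFit b = startsDesc b ≡ false × NoEndDesc (star b)

-- node a b = skew (node a leaf) b, and star (node a b) = skew (star b) (node (star a) leaf).
Simsun-node : ∀ a b → Simsun (node a b) ⟺ (Simsun a × Simsun b × (isNode b ≡ true → NoEndDesc a × startsDesc b ≡ false))
Simsun-node a b = to , from
  where
  to : Simsun (node a b) → Simsun a × Simsun b × (isNode b ≡ true → NoEndDesc a × startsDesc b ≡ false)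
  to S with proj₁ (Simsun-skew (node a leaf) b) S
  ... | s1 , s2 , h = proj₁ (Simsun-node-leaf a) s1 , s2 , λ nb → proj₁ (NoEndDesc-node-leaf a) (proj₁ (h refl nb)) , proj₂ (h refl nb)
  from : Simsun a × Simsun b × (isNode b ≡ true → NoEndDesc a × startsDesc b ≡ false) → Simsun (node a b)
  from (sa , sb , h) = proj₂ (Simsun-skew (node a leaf) b) (proj₂ (Simsun-node-leaf a) sa , sb ,
         λ _ nb → proj₂ (NoEndDesc-node-leaf a) (proj₁ (h nb)) , proj₂ (h nb))

Simsun-star-node : ∀ a b → Simsun (star (node a b)) ⟺
    (Simsun (star a) × Simsun (star b) × (isNode b ≡ true → NoEndDesc (star b) × startsDesc (star a) ≡ false))
Simsun-star-node a b = to , from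
  where
  to : Simsun (star (node a b)) → Simsun (star a) × Simsun (star b) × (isNode b ≡ true → NoEndDesc (star b) × startsDesc (star a) ≡ false)
  to S with proj₁ (Simsun-skew (star b) (node (star a) leaf)) S
  ... | s1 , s2 , h = proj₁ (Simsun-node-leaf (star a)) s2 , s1 ,
        λ nb → proj₁ (h (trans (isNode-star b) nb) refl) , trans (sym (startsDesc-node-leaf (star a))) (proj₂ (h (trans (isNode-star b) nb) refl))
  from : Simsun (star a) × Simsun (star b) × (isNode b ≡ true → NoEndDesc (star b) × startsDesc (star a) ≡ false) → Simsun (star (node a b))
  from (sa , sb , h) = proj₂ (Simsun-skew (star b) (node (star a) leaf)) (sb , proj₂ (Simsun-node-leaf (star a)) sa ,
         λ nb _ → proj₁ (h (trans (sym (isNode-star b)) nb)) , trans (startsDesc-node-leaf (star a)) (proj₂ (h (trans (sym (isNode-star b)) nb))))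

BiSimsun-node : ∀ a b → BiSimsun (node a b) ⟺ (BiSimsun a × BiSimsun b × (isNode b ≡ true → LeftFit a × RightFit b))
BiSimsun-node a b = to , from
  where
  to : BiSimsun (node a b) → BiSimsun a × BiSimsun b × (isNode b ≡ true → LeftFit a × RightFit b)
  to (S₁ , S₂) with proj₁ (Simsun-node a b) S₁ | proj₁ (Simsun-star-node a b) S₂
  ... | sa , sb , h | sa′ , sb′ , h′ = (sa , sa′) , (sb , sb′) ,
        λ nb → (proj₁ (h nb) , proj₂ (h′ nb)) , (proj₂ (h nb) , proj₁ (h′ nb))
  from : BiSimsun a × BiSimsun b × (isNode b ≡ true → LeftFit a × RightFit b) → BiSimsun (node a b)
  from ((sa , sa′) , (sb , sb′) , h) = proj₂ (Simsun-node a b) (sa , sb , λ nb → proj₁ (proj₁ (h nb)) , proj₁ (proj₂ (h nb)))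
     , proj₂ (Simsun-star-node a b) (sa′ , sb′ , λ nb → proj₂ (proj₂ (h nb)) , proj₂ (proj₁ (h nb)))

BiSimsun-leaf : BiSimsun leaf
BiSimsun-leaf = Simsun-leaf , Simsun-leaf

LeftFit-node : ∀ x y → LeftFit (node x y) ⟺ ((isNode y ≡ false → LeftFit x) × (isNode y ≡ true → isSingleton y ≡ false × LeftFit y))
LeftFit-node x leaf = (λ { (n , f) → (λ _ → proj₁ (NoEndDesc-node-leaf x) n , trans (sym (startsDesc-node-leaf (star x))) f) , (λ ()) })
           , (λ h → let (n , f) = proj₁ h refl in proj₂ (NoEndDesc-node-leaf x) n , trans (startsDesc-node-leaf (star x)) f)
LeftFit-node x (node p q) = to , from
  where
  y : Tree
  y = node p q
  to : LeftFit (node x y) → (isNode y ≡ false → LeftFit x) × (isNode y ≡ true → isSingleton y ≡ false × LeftFit y)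
  to (n , f) with proj₁ (NoEndDesc-skew (node x leaf) y) n | proj₁ (startsDesc-skew (star y) (node (star x) leaf)) f
  ... | n1 , _ , n3 | _ , f2 , _ = (λ ()) , λ _ → n3 refl , n1 , f2
  from : (isNode y ≡ false → LeftFit x) × (isNode y ≡ true → isSingleton y ≡ false × LeftFit y) → LeftFit (node x y)
  from (_ , h) with h refl
  ... | s , n1 , f2 = proj₂ (NoEndDesc-skew (node x leaf) y) (n1 , (λ ()) , (λ _ → s))
       , proj₂ (startsDesc-skew (star y) (node (star x) leaf)) ((λ e → ⊥-elim (true≢false (trans (sym (isNode-star y)) e))) , f2 ,
           λ e → ⊥-elim (true≢false (trans (sym e) (trans (isSingleton-star y) s))))

RightFit-node : ∀ x y → RightFit (node x y) ⟺ ((isNode y ≡ false → RightFit x) × (isNode y ≡ true → isNode x ≡ true × RightFit x))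
RightFit-node x leaf = (λ { (f , n) → (λ _ → trans (sym (startsDesc-node-leaf x)) f , proj₁ (NoEndDesc-node-leaf (star x)) n) , (λ ()) })
           , (λ h → let (f , n) = proj₁ h refl in trans (startsDesc-node-leaf x) f , proj₂ (NoEndDesc-node-leaf (star x)) n)
RightFit-node x (node p q) = to , from
  where
  y : Tree
  y = node p q
  nx : ∀ x → (isNode x ≡ false → true ≡ false) → isNode x ≡ true
  nx leaf h = ⊥-elim (true≢false (h refl))
  nx (node _ _) h = refl
  to : RightFit (node x y) → (isNode y ≡ false → RightFit x) × (isNode y ≡ true → isNode x ≡ true × RightFit x)
  to (f , n) with proj₁ (startsDesc-node x y) f | proj₁ (NoEndDesc-skew (star y) (node (star x) leaf)) n
  ... | f1 , f2 | n1 , _ , n3 = (λ ()) , λ _ → nx x f1 , f2 , proj₁ (NoEndDesc-node-leaf (star x)) n1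
  from : (isNode y ≡ false → RightFit x) × (isNode y ≡ true → isNode x ≡ true × RightFit x) → RightFit (node x y)
  from (_ , h) with h refl
  ... | ix , f2 , n1 = proj₂ (startsDesc-node x y) ((λ e → ⊥-elim (true≢false (trans (sym ix) e))) , f2)
       , proj₂ (NoEndDesc-skew (star y) (node (star x) leaf)) (proj₂ (NoEndDesc-node-leaf (star x)) n1 , (λ ()) ,
           λ _ → proj₂ (isSingleton-node-leaf (star x)) (trans (isNode-star x) ix))

LeftFit-leaf : LeftFit leaf
LeftFit-leaf = NoEndDesc-leaf , refl

RightFit-leaf : RightFit leaf
RightFit-leaf = refl , NoEndDesc-leaf

-- Unfolding BiSimsun-node, LeftFit-node and RightFit-node along
-- right spines gives four mutually recursive classes, characterised by
--   Gram = BiSimsun,  GramL = BiSimsun ∩ LeftFit,  GramR = BiSimsun ∩ RightFit,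
--   GramLR = BiSimsun ∩ LeftFit ∩ RightFit          (Gram⟺BiSimsun, GramL⟺LeftFit, …).

NotSingleton : Tree → Tree → Set
NotSingleton leaf leaf = ⊥
NotSingleton leaf (node _ _) = ⊤
NotSingleton (node _ _) _ = ⊤

Gram GramL GramR GramLR : Tree → Set
Gram leaf = ⊤
Gram (node a leaf) = Gram a
Gram (node a (node c d)) = GramL a × GramR (node c d)
GramL leaf = ⊤
GramL (node a leaf) = GramL a
GramL (node a (node c d)) = GramL a × GramLR (node c d) × NotSingleton c d
GramR leaf = ⊤
GramR (node a leaf) = GramR a
GramR (node a (node c d)) = GramLR a × isNode a ≡ true × GramR (node c d)
GramLR leaf = ⊤
GramLR (node a leaf) = GramLR a
GramLR (node a (node c d)) = GramLR a × isNode a ≡ true × GramLR (node c d) × NotSingleton c d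

-- Coding grammar trees by paths, along the right spine: a node with empty
-- right child gives a level step L, a node with right child node c d gives an
-- arch U (code of its left subtree) D followed by the code of node c d.  The
-- codes placed inside arches (codeL, codeLR′) never start with U, so no UU
-- arises.  codeR-node a b and codeLR-node a b are codeR (node a b) and
-- codeLR (node a b) without the leading L, codeLR′ extends codeLR-node to
-- leaves, and codeLR⁻ c d codes a right child node c d with one step less.
code codeL codeR codeLR codeLR′ : Tree → List Step
codeR-node codeLR-node codeLR⁻ : Tree → Tree → List Step
code leaf = []
code (node a leaf) = L ∷ code a
code (node a (node c d)) = U ∷ codeL a ++ D ∷ codeR-node c d
codeL leaf = []
codeL (node a leaf) = L ∷ codeL a
codeL (node a (node c d)) = L ∷ U ∷ codeL a ++ D ∷ codeLR⁻ c d
codeR leaf = []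
codeR (node a b) = L ∷ codeR-node a b
codeR-node a leaf = codeR a
codeR-node a (node c d) = U ∷ codeLR′ a ++ D ∷ codeR-node c d
codeLR leaf = []
codeLR (node a b) = L ∷ codeLR-node a b
codeLR-node a leaf = codeLR a
codeLR-node a (node c d) = L ∷ U ∷ codeLR′ a ++ D ∷ codeLR⁻ c d
codeLR′ leaf = []
codeLR′ (node a b) = codeLR-node a b
codeLR⁻ leaf leaf = []
codeLR⁻ (node c1 c2) leaf = codeLR-node c1 c2
codeLR⁻ c (node e f) = U ∷ codeLR′ c ++ D ∷ codeLR⁻ e f

NotSingleton⇒¬isSingleton : ∀ c d → NotSingleton c d → isSingleton (node c d) ≡ false
NotSingleton⇒¬isSingleton leaf (node _ _) _ = refl
NotSingleton⇒¬isSingleton (node _ _) leaf _ = refl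
NotSingleton⇒¬isSingleton (node _ _) (node _ _) _ = refl

¬isSingleton⇒NotSingleton : ∀ c d → isSingleton (node c d) ≡ false → NotSingleton c d
¬isSingleton⇒NotSingleton leaf leaf ()
¬isSingleton⇒NotSingleton leaf (node _ _) _ = tt
¬isSingleton⇒NotSingleton (node _ _) _ _ = tt

Gram-node-leaf : ∀ a → (Gram a ⟺ BiSimsun a) → Gram a ⟺ BiSimsun (node a leaf)
Gram-node-leaf a IH = (λ h → proj₂ (BiSimsun-node a leaf) (proj₁ IH h , BiSimsun-leaf , λ ()))
             , (λ g → proj₂ IH (proj₁ (proj₁ (BiSimsun-node a leaf) g)))

Gram-node-node : ∀ a c d → (GramL a ⟺ (BiSimsun a × LeftFit a)) → (GramR (node c d) ⟺ (BiSimsun (node c d) × RightFit (node c d))) →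
        (GramL a × GramR (node c d)) ⟺ BiSimsun (node a (node c d))
Gram-node-node a c d IHa IHb =
  (λ h → proj₂ (BiSimsun-node a b) (proj₁ (proj₁ IHa (proj₁ h)) , proj₁ (proj₁ IHb (proj₂ h)) ,
      λ _ → proj₂ (proj₁ IHa (proj₁ h)) , proj₂ (proj₁ IHb (proj₂ h))))
  , (λ g → let k = proj₁ (BiSimsun-node a b) g in
      proj₂ IHa (proj₁ k , proj₁ (proj₂ (proj₂ k) refl)) , proj₂ IHb (proj₁ (proj₂ k) , proj₂ (proj₂ (proj₂ k) refl)))
  where
    b : Tree
    b = node c d

GramL-node-leaf : ∀ a → (GramL a ⟺ (BiSimsun a × LeftFit a)) → GramL a ⟺ (BiSimsun (node a leaf) × LeftFit (node a leaf))
GramL-node-leaf a IH = (λ h → proj₂ (BiSimsun-node a leaf) (proj₁ (proj₁ IH h) , BiSimsun-leaf , λ ()) ,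
                      proj₂ (LeftFit-node a leaf) ((λ _ → proj₂ (proj₁ IH h)) , λ ()))
             , (λ gx → proj₂ IH (proj₁ (proj₁ (BiSimsun-node a leaf) (proj₁ gx)) , proj₁ (proj₁ (LeftFit-node a leaf) (proj₂ gx)) refl))

GramL-node-node : ∀ a c d → (GramL a ⟺ (BiSimsun a × LeftFit a)) →
    (GramLR (node c d) ⟺ (BiSimsun (node c d) × LeftFit (node c d) × RightFit (node c d))) →
        (GramL a × GramLR (node c d) × NotSingleton c d) ⟺ (BiSimsun (node a (node c d)) × LeftFit (node a (node c d)))
GramL-node-node a c d IHa IHb =
  (λ { (hx , hxy , ns) → let ga = proj₁ (proj₁ IHa hx) ; xa = proj₂ (proj₁ IHa hx)
                             b3 = proj₁ IHb hxy in
       proj₂ (BiSimsun-node a b) (ga , proj₁ b3 , λ _ → xa , proj₂ (proj₂ b3)) ,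
       proj₂ (LeftFit-node a b) ((λ ()) , λ _ → NotSingleton⇒¬isSingleton c d ns , proj₁ (proj₂ b3)) })
  , (λ { (g , x) → let k = proj₁ (BiSimsun-node a b) g ; k2 = proj₂ (proj₁ (LeftFit-node a b) x) refl in
       proj₂ IHa (proj₁ k , proj₁ (proj₂ (proj₂ k) refl)) ,
       proj₂ IHb (proj₁ (proj₂ k) , proj₂ k2 , proj₂ (proj₂ (proj₂ k) refl)) ,
       ¬isSingleton⇒NotSingleton c d (proj₁ k2) })
  where
    b : Tree
    b = node c d

GramR-node-leaf : ∀ a → (GramR a ⟺ (BiSimsun a × RightFit a)) → GramR a ⟺ (BiSimsun (node a leaf) × RightFit (node a leaf))
GramR-node-leaf a IH = (λ h → proj₂ (BiSimsun-node a leaf) (proj₁ (proj₁ IH h) , BiSimsun-leaf , λ ()) ,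
                      proj₂ (RightFit-node a leaf) ((λ _ → proj₂ (proj₁ IH h)) , λ ()))
             , (λ gy → proj₂ IH (proj₁ (proj₁ (BiSimsun-node a leaf) (proj₁ gy)) , proj₁ (proj₁ (RightFit-node a leaf) (proj₂ gy)) refl))

GramR-node-node : ∀ a c d → (GramLR a ⟺ (BiSimsun a × LeftFit a × RightFit a)) → (GramR (node c d) ⟺ (BiSimsun (node c d) × RightFit (node c d))) →
        (GramLR a × isNode a ≡ true × GramR (node c d)) ⟺ (BiSimsun (node a (node c d)) × RightFit (node a (node c d)))
GramR-node-node a c d IHa IHb =
  (λ { (hxy , na , hy) → let a3 = proj₁ IHa hxy ; b2 = proj₁ IHb hy in
       proj₂ (BiSimsun-node a b) (proj₁ a3 , proj₁ b2 , λ _ → proj₁ (proj₂ a3) , proj₂ b2) ,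
       proj₂ (RightFit-node a b) ((λ ()) , λ _ → na , proj₂ (proj₂ a3)) })
  , (λ { (g , y) → let k = proj₁ (BiSimsun-node a b) g ; k2 = proj₂ (proj₁ (RightFit-node a b) y) refl in
       proj₂ IHa (proj₁ k , proj₁ (proj₂ (proj₂ k) refl) , proj₂ k2) , proj₁ k2 ,
       proj₂ IHb (proj₁ (proj₂ k) , proj₂ (proj₂ (proj₂ k) refl)) })
  where
    b : Tree
    b = node c d

GramLR-node-leaf : ∀ a → (GramLR a ⟺ (BiSimsun a × LeftFit a × RightFit a)) → GramLR a ⟺
    (BiSimsun (node a leaf) × LeftFit (node a leaf) × RightFit (node a leaf))
GramLR-node-leaf a IH = (λ h → let r = proj₁ IH h in
                   proj₂ (BiSimsun-node a leaf) (proj₁ r , BiSimsun-leaf , λ ()) ,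
                   proj₂ (LeftFit-node a leaf) ((λ _ → proj₁ (proj₂ r)) , λ ()) ,
                   proj₂ (RightFit-node a leaf) ((λ _ → proj₂ (proj₂ r)) , λ ()))
              , (λ { (g , x , y) → proj₂ IH (proj₁ (proj₁ (BiSimsun-node a leaf) g) ,
                    proj₁ (proj₁ (LeftFit-node a leaf) x) refl , proj₁ (proj₁ (RightFit-node a leaf) y) refl) })

GramLR-node-node : ∀ a c d → (GramLR a ⟺ (BiSimsun a × LeftFit a × RightFit a)) →
    (GramLR (node c d) ⟺ (BiSimsun (node c d) × LeftFit (node c d) × RightFit (node c d))) →
        (GramLR a × isNode a ≡ true × GramLR (node c d) × NotSingleton c d) ⟺
            (BiSimsun (node a (node c d)) × LeftFit (node a (node c d)) × RightFit (node a (node c d)))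
GramLR-node-node a c d IHa IHb =
  (λ { (hxy , na , hxy′ , ns) → let a3 = proj₁ IHa hxy ; b3 = proj₁ IHb hxy′ in
       proj₂ (BiSimsun-node a b) (proj₁ a3 , proj₁ b3 , λ _ → proj₁ (proj₂ a3) , proj₂ (proj₂ b3)) ,
       proj₂ (LeftFit-node a b) ((λ ()) , λ _ → NotSingleton⇒¬isSingleton c d ns , proj₁ (proj₂ b3)) ,
       proj₂ (RightFit-node a b) ((λ ()) , λ _ → na , proj₂ (proj₂ a3)) })
  , (λ { (g , x , y) → let k = proj₁ (BiSimsun-node a b) g
                           kx = proj₂ (proj₁ (LeftFit-node a b) x) refl
                           ky = proj₂ (proj₁ (RightFit-node a b) y) refl in
       proj₂ IHa (proj₁ k , proj₁ (proj₂ (proj₂ k) refl) , proj₂ ky) , proj₁ ky ,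
       proj₂ IHb (proj₁ (proj₂ k) , proj₂ kx , proj₂ (proj₂ (proj₂ k) refl)) ,
       ¬isSingleton⇒NotSingleton c d (proj₁ kx) })
  where
    b : Tree
    b = node c d

Gram⟺BiSimsun : ∀ t → Gram t ⟺ BiSimsun t
GramL⟺LeftFit : ∀ t → GramL t ⟺ (BiSimsun t × LeftFit t)
GramR⟺RightFit : ∀ t → GramR t ⟺ (BiSimsun t × RightFit t)
GramLR⟺BothFit : ∀ t → GramLR t ⟺ (BiSimsun t × LeftFit t × RightFit t)
Gram⟺BiSimsun leaf = (λ _ → BiSimsun-leaf) , (λ _ → tt)
Gram⟺BiSimsun (node a leaf) = Gram-node-leaf a (Gram⟺BiSimsun a)
Gram⟺BiSimsun (node a (node c d)) = Gram-node-node a c d (GramL⟺LeftFit a) (GramR⟺RightFit (node c d))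
GramL⟺LeftFit leaf = (λ _ → BiSimsun-leaf , LeftFit-leaf) , (λ _ → tt)
GramL⟺LeftFit (node a leaf) = GramL-node-leaf a (GramL⟺LeftFit a)
GramL⟺LeftFit (node a (node c d)) = GramL-node-node a c d (GramL⟺LeftFit a) (GramLR⟺BothFit (node c d))
GramR⟺RightFit leaf = (λ _ → BiSimsun-leaf , RightFit-leaf) , (λ _ → tt)
GramR⟺RightFit (node a leaf) = GramR-node-leaf a (GramR⟺RightFit a)
GramR⟺RightFit (node a (node c d)) = GramR-node-node a c d (GramLR⟺BothFit a) (GramR⟺RightFit (node c d))
GramLR⟺BothFit leaf = (λ _ → BiSimsun-leaf , LeftFit-leaf , RightFit-leaf) , (λ _ → tt)
GramLR⟺BothFit (node a leaf) = GramLR-node-leaf a (GramLR⟺BothFit a)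
GramLR⟺BothFit (node a (node c d)) = GramLR-node-node a c d (GramLR⟺BothFit a) (GramLR⟺BothFit (node c d))

startsUp : List Step → Bool
startsUp (U ∷ _) = true
startsUp _ = false

Motzkin : List Step → Set
Motzkin p = validFrom 0 p ≡ true × noUU p ≡ true

valid-U : ∀ h p → validFrom h (U ∷ p) ≡ validFrom (suc h) p
valid-U zero p = refl
valid-U (suc h) p = refl

valid-L : ∀ h p → validFrom h (L ∷ p) ≡ validFrom h p
valid-L zero p = refl
valid-L (suc h) p = refl

valid-++ : ∀ c h P Q → validFrom c P ≡ true → validFrom (c + h) (P ++ Q) ≡ validFrom h Q
valid-++ zero h [] Q e = refl
valid-++ (suc c) h [] Q ()
valid-++ c h (U ∷ P) Q e = trans (valid-U (c + h) (P ++ Q)) (valid-++ (suc c) h P Q (trans (sym (valid-U c P)) e))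
valid-++ c h (L ∷ P) Q e = trans (valid-L (c + h) (P ++ Q)) (valid-++ c h P Q (trans (sym (valid-L c P)) e))
valid-++ zero h (D ∷ P) Q ()
valid-++ (suc c) h (D ∷ P) Q e = valid-++ c h P Q e

noUU-U : ∀ x → startsUp x ≡ false → noUU (U ∷ x) ≡ noUU x
noUU-U [] _ = refl
noUU-U (D ∷ x) _ = refl
noUU-U (L ∷ x) _ = refl

noUU-D : ∀ P Q → noUU P ≡ true → noUU Q ≡ true → noUU (P ++ D ∷ Q) ≡ true
noUU-D [] Q _ q = q
noUU-D (U ∷ []) Q _ q = q
noUU-D (U ∷ U ∷ P) Q () q
noUU-D (U ∷ D ∷ P) Q p q = noUU-D (D ∷ P) Q p q
noUU-D (U ∷ L ∷ P) Q p q = noUU-D (L ∷ P) Q p q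
noUU-D (D ∷ P) Q p q = noUU-D P Q p q
noUU-D (L ∷ P) Q p q = noUU-D P Q p q

Motzkin-arch : ∀ P Q → Motzkin P → startsUp P ≡ false → Motzkin Q → Motzkin (U ∷ P ++ D ∷ Q)
Motzkin-arch P Q (vP , nP) hP (vQ , nQ) =
  trans (valid-++ 0 1 P (D ∷ Q) vP) vQ ,
  trans (noUU-U (P ++ D ∷ Q) (hd P hP)) (noUU-D P Q nP nQ)
  where
  hd : ∀ P → startsUp P ≡ false → startsUp (P ++ D ∷ Q) ≡ false
  hd [] _ = refl
  hd (D ∷ _) _ = refl
  hd (L ∷ _) _ = refl

-- The codes are such paths; those of GramL and GramR trees do not start with U,
-- so that they may be put inside an arch.
code-Motzkin : ∀ t → Gram t → Motzkin (code t)
codeL-Motzkin : ∀ t → GramL t → Motzkin (codeL t) × startsUp (codeL t) ≡ false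
codeR-Motzkin : ∀ t → GramR t → Motzkin (codeR t) × startsUp (codeR t) ≡ false
codeR-node-Motzkin : ∀ a b → GramR (node a b) → Motzkin (codeR-node a b)
codeLR-node-Motzkin : ∀ a b → GramLR (node a b) → Motzkin (codeLR-node a b) × startsUp (codeLR-node a b) ≡ false
codeLR⁻-Motzkin : ∀ c d → GramLR (node c d) → NotSingleton c d → Motzkin (codeLR⁻ c d)
code-Motzkin leaf _ = refl , refl
code-Motzkin (node a leaf) h = code-Motzkin a h
code-Motzkin (node a (node c d)) (hx , hy) = Motzkin-arch (codeL a) (codeR-node c d) (proj₁ (codeL-Motzkin a hx))
    (proj₂ (codeL-Motzkin a hx)) (codeR-node-Motzkin c d hy)
codeL-Motzkin leaf _ = (refl , refl) , refl
codeL-Motzkin (node a leaf) h = proj₁ (codeL-Motzkin a h) , refl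
codeL-Motzkin (node a (node c d)) (hx , hxy , ns) = Motzkin-arch (codeL a) (codeLR⁻ c d) (proj₁ (codeL-Motzkin a hx))
    (proj₂ (codeL-Motzkin a hx)) (codeLR⁻-Motzkin c d hxy ns) , refl
codeR-Motzkin leaf _ = (refl , refl) , refl
codeR-Motzkin (node a b) h = codeR-node-Motzkin a b h , refl
codeR-node-Motzkin a leaf h = proj₁ (codeR-Motzkin a h)
codeR-node-Motzkin (node a1 a2) (node c d) (hxy , _ , hy) = Motzkin-arch (codeLR-node a1 a2) (codeR-node c d)
    (proj₁ (codeLR-node-Motzkin a1 a2 hxy)) (proj₂ (codeLR-node-Motzkin a1 a2 hxy)) (codeR-node-Motzkin c d hy)
codeR-node-Motzkin leaf (node c d) (_ , () , _)
codeLR-node-Motzkin leaf leaf h = (refl , refl) , refl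
codeLR-node-Motzkin (node a1 a2) leaf h = proj₁ (codeLR-node-Motzkin a1 a2 h) , refl
codeLR-node-Motzkin (node a1 a2) (node c d) (hxy , _ , hxy′ , ns) = Motzkin-arch (codeLR-node a1 a2) (codeLR⁻ c d)
    (proj₁ (codeLR-node-Motzkin a1 a2 hxy)) (proj₂ (codeLR-node-Motzkin a1 a2 hxy)) (codeLR⁻-Motzkin c d hxy′ ns) , refl
codeLR-node-Motzkin leaf (node c d) (_ , () , _)
codeLR⁻-Motzkin leaf leaf _ ()
codeLR⁻-Motzkin (node c1 c2) leaf h _ = proj₁ (codeLR-node-Motzkin c1 c2 h)
codeLR⁻-Motzkin (node c1 c2) (node e f) (hxy , _ , hxy′ , ns) _ = Motzkin-arch (codeLR-node c1 c2) (codeLR⁻ e f)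
    (proj₁ (codeLR-node-Motzkin c1 c2 hxy)) (proj₂ (codeLR-node-Motzkin c1 c2 hxy)) (codeLR⁻-Motzkin e f hxy′ ns)
codeLR⁻-Motzkin leaf (node e f) (_ , () , _) _

length-LU-arch : ∀ P Q (A B : ℕ) → length P ≡ A → suc (length Q) ≡ B → suc (suc (length (P ++ D ∷ Q))) ≡ suc (A + suc B)
length-LU-arch P Q A B e1 e2 rewrite length-++ P {D ∷ Q} | e1 | sym e2 = cong suc (sym (+-suc A (suc (length Q))))

length-U-arch : ∀ P Q A B → length P ≡ A → length Q ≡ B → length (U ∷ P ++ D ∷ Q) ≡ suc (A + suc B)
length-U-arch P Q A B e1 e2 rewrite length-++ P {D ∷ Q} | e1 | e2 = refl

code-length : ∀ t → Gram t → length (code t) ≡ size t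
codeL-length : ∀ t → GramL t → length (codeL t) ≡ size t
codeR-length : ∀ t → GramR t → length (codeR t) ≡ size t
codeR-node-length : ∀ a b → GramR (node a b) → length (codeR-node a b) ≡ size a + size b
codeLR-node-length : ∀ a b → GramLR (node a b) → length (codeLR-node a b) ≡ size a + size b
codeLR⁻-length : ∀ c d → GramLR (node c d) → NotSingleton c d → suc (length (codeLR⁻ c d)) ≡ size c + size d
code-length leaf _ = refl
code-length (node a leaf) h = cong suc (trans (code-length a h) (sym (+-identityʳ _)))
code-length (node a (node c d)) (hx , hy) = length-U-arch (codeL a) (codeR-node c d) _ _ (codeL-length a hx) (codeR-node-length c d hy)
codeL-length leaf _ = refl
codeL-length (node a leaf) h = cong suc (trans (codeL-length a h) (sym (+-identityʳ _)))
codeL-length (node a (node c d)) (hx , hxy , ns) = length-LU-arch (codeL a) (codeLR⁻ c d) _ _ (codeL-length a hx) (codeLR⁻-length c d hxy ns)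
codeR-length leaf _ = refl
codeR-length (node a b) h = cong suc (codeR-node-length a b h)
codeR-node-length a leaf h = trans (codeR-length a h) (sym (+-identityʳ _))
codeR-node-length (node a1 a2) (node c d) (hxy , _ , hy) = length-U-arch (codeLR-node a1 a2) (codeR-node c d) _ _
    (codeLR-node-length a1 a2 hxy) (codeR-node-length c d hy)
codeR-node-length leaf (node c d) (_ , () , _)
codeLR-node-length leaf leaf _ = refl
codeLR-node-length (node a1 a2) leaf h = trans (cong suc (codeLR-node-length a1 a2 h)) (sym (+-identityʳ _))
codeLR-node-length (node a1 a2) (node c d) (hxy , _ , hxy′ , ns) = length-LU-arch (codeLR-node a1 a2) (codeLR⁻ c d) _ _
    (codeLR-node-length a1 a2 hxy) (codeLR⁻-length c d hxy′ ns)
codeLR-node-length leaf (node c d) (_ , () , _)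
codeLR⁻-length leaf leaf _ ()
codeLR⁻-length (node c1 c2) leaf h _ = trans (cong suc (codeLR-node-length c1 c2 h)) (sym (+-identityʳ _))
codeLR⁻-length (node c1 c2) (node e f) (hxy , _ , hxy′ , ns) _ = length-LU-arch (codeLR-node c1 c2) (codeLR⁻ e f) _ _
    (codeLR-node-length c1 c2 hxy) (codeLR⁻-length e f hxy′ ns)
codeLR⁻-length leaf (node e f) (_ , () , _) _

-- First-return decomposition: a path from height c splits at its first down
-- step to height below c; arches U P D Q are thereby uniquely decomposed.
firstReturn : ℕ → List Step → List Step × List Step
firstReturn c [] = [] , []
firstReturn c (U ∷ p) = map₁ (U ∷_) (firstReturn (suc c) p)
firstReturn c (L ∷ p) = map₁ (L ∷_) (firstReturn c p)
firstReturn zero (D ∷ p) = [] , p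
firstReturn (suc c) (D ∷ p) = map₁ (D ∷_) (firstReturn c p)

firstReturn-arch : ∀ c P Q → validFrom c P ≡ true → firstReturn c (P ++ D ∷ Q) ≡ (P , Q)
firstReturn-arch zero [] Q _ = refl
firstReturn-arch (suc c) [] Q ()
firstReturn-arch c (U ∷ P) Q e rewrite firstReturn-arch (suc c) P Q (trans (sym (valid-U c P)) e) = refl
firstReturn-arch c (L ∷ P) Q e rewrite firstReturn-arch c P Q (trans (sym (valid-L c P)) e) = refl
firstReturn-arch zero (D ∷ P) Q ()
firstReturn-arch (suc c) (D ∷ P) Q e rewrite firstReturn-arch c P Q e = refl

arch-injective : ∀ P Q P′ Q′ → validFrom 0 P ≡ true → validFrom 0 P′ ≡ true → P ++ D ∷ Q ≡ P′ ++ D ∷ Q′ → P ≡ P′ × Q ≡ Q′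
arch-injective P Q P′ Q′ vP vP′ e = cong proj₁ h , cong proj₂ h
  where
  h : (P , Q) ≡ (P′ , Q′)
  h = trans (sym (firstReturn-arch 0 P Q vP)) (trans (cong (firstReturn 0) e) (firstReturn-arch 0 P′ Q′ vP′))

arch-split : ∀ c h p → validFrom (c + suc h) p ≡ true →
  Σ (List Step) (λ P → Σ (List Step) (λ Q → p ≡ P ++ D ∷ Q × validFrom c P ≡ true × validFrom h Q ≡ true))
arch-split c h [] e rewrite +-suc c h = ⊥-elim (true≢false (sym e))
arch-split c h (U ∷ p) e with arch-split (suc c) h p (trans (sym (valid-U (c + suc h) p)) e)
... | P , Q , refl , vP , vQ = U ∷ P , Q , refl , trans (valid-U c P) vP , vQ
arch-split c h (L ∷ p) e with arch-split c h p (trans (sym (valid-L (c + suc h) p)) e)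
... | P , Q , refl , vP , vQ = L ∷ P , Q , refl , trans (valid-L c P) vP , vQ
arch-split zero h (D ∷ p) e = [] , p , refl , refl , e
arch-split (suc c) h (D ∷ p) e with arch-split c h p e
... | P , Q , refl , vP , vQ = D ∷ P , Q , refl , vP , vQ

startsUp-contra : ∀ {p q} → startsUp p ≡ false → p ≡ U ∷ q → ⊥
startsUp-contra h refl = true≢false h

-- The codes are injective, by decomposing at the first return.
code-injective : ∀ t1 t2 → Gram t1 → Gram t2 → code t1 ≡ code t2 → t1 ≡ t2
codeL-injective : ∀ t1 t2 → GramL t1 → GramL t2 → codeL t1 ≡ codeL t2 → t1 ≡ t2
codeR-injective : ∀ t1 t2 → GramR t1 → GramR t2 → codeR t1 ≡ codeR t2 → t1 ≡ t2
codeR-node-injective : ∀ a b a′ b′ → GramR (node a b) → GramR (node a′ b′) → codeR-node a b ≡ codeR-node a′ b′ → node a b ≡ node a′ b′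
codeLR-node-injective : ∀ a b a′ b′ → GramLR (node a b) → GramLR (node a′ b′) → codeLR-node a b ≡ codeLR-node a′ b′ → node a b ≡ node a′ b′
codeLR-injective : ∀ t1 t2 → GramLR t1 → GramLR t2 → codeLR t1 ≡ codeLR t2 → t1 ≡ t2
codeLR⁻-injective : ∀ c d c′ d′ → GramLR (node c d) → NotSingleton c d → GramLR (node c′ d′) → NotSingleton c′ d′ → codeLR⁻ c
    d ≡ codeLR⁻ c′ d′ → node c d ≡ node c′ d′

code-injective leaf leaf _ _ _ = refl
code-injective leaf (node a leaf) _ _ ()
code-injective leaf (node a (node c d)) _ _ ()
code-injective (node a leaf) leaf _ _ ()
code-injective (node a (node c d)) leaf _ _ ()
code-injective (node a leaf) (node a′ leaf) h h′ e = cong (λ t → node t leaf) (code-injective a a′ h h′ (∷-injectiveʳ e))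
code-injective (node a leaf) (node a′ (node c d)) _ _ ()
code-injective (node a (node c d)) (node a′ leaf) _ _ ()
code-injective (node a (node c d)) (node a′ (node c′ d′)) (hx , hy) (hx′ , hy′) e
  with arch-injective (codeL a) (codeR-node c d) (codeL a′) (codeR-node c′ d′) (proj₁ (proj₁ (codeL-Motzkin a hx)))
      (proj₁ (proj₁ (codeL-Motzkin a′ hx′))) (∷-injectiveʳ e)
... | e1 , e2 = cong₂ node (codeL-injective a a′ hx hx′ e1) (codeR-node-injective c d c′ d′ hy hy′ e2)

codeL-injective leaf leaf _ _ _ = refl
codeL-injective leaf (node a leaf) _ _ ()
codeL-injective leaf (node a (node c d)) _ _ ()
codeL-injective (node a leaf) leaf _ _ ()
codeL-injective (node a (node c d)) leaf _ _ ()
codeL-injective (node a leaf) (node a′ leaf) h h′ e = cong (λ t → node t leaf) (codeL-injective a a′ h h′ (∷-injectiveʳ e))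
codeL-injective (node a leaf) (node a′ (node c d)) h _ e = ⊥-elim (startsUp-contra (proj₂ (codeL-Motzkin a h)) (∷-injectiveʳ e))
codeL-injective (node a (node c d)) (node a′ leaf) _ h e = ⊥-elim (startsUp-contra (proj₂ (codeL-Motzkin a′ h)) (sym (∷-injectiveʳ e)))
codeL-injective (node a (node c d)) (node a′ (node c′ d′)) (hx , hxy , ns) (hx′ , hxy′ , ns′) e
  with arch-injective (codeL a) (codeLR⁻ c d) (codeL a′) (codeLR⁻ c′ d′) (proj₁ (proj₁ (codeL-Motzkin a hx)))
      (proj₁ (proj₁ (codeL-Motzkin a′ hx′))) (∷-injectiveʳ (∷-injectiveʳ e))
... | e1 , e2 = cong₂ node (codeL-injective a a′ hx hx′ e1) (codeLR⁻-injective c d c′ d′ hxy ns hxy′ ns′ e2)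

codeR-injective leaf leaf _ _ _ = refl
codeR-injective leaf (node a b) _ _ ()
codeR-injective (node a b) leaf _ _ ()
codeR-injective (node a b) (node a′ b′) h h′ e = codeR-node-injective a b a′ b′ h h′ (∷-injectiveʳ e)

codeR-node-injective a leaf a′ leaf h h′ e = cong (λ t → node t leaf) (codeR-injective a a′ h h′ e)
codeR-node-injective a leaf (node a1 a2) (node c d) h _ e = ⊥-elim (startsUp-contra (proj₂ (codeR-Motzkin a h)) e)
codeR-node-injective (node a1 a2) (node c d) a′ leaf _ h e = ⊥-elim (startsUp-contra (proj₂ (codeR-Motzkin a′ h)) (sym e))
codeR-node-injective (node a1 a2) (node c d) (node a1′ a2′) (node c′ d′) (hxy , _ , hy) (hxy′ , _ , hy′) e
  with arch-injective (codeLR-node a1 a2) (codeR-node c d) (codeLR-node a1′ a2′) (codeR-node c′ d′)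
      (proj₁ (proj₁ (codeLR-node-Motzkin a1 a2 hxy))) (proj₁ (proj₁ (codeLR-node-Motzkin a1′ a2′ hxy′))) (∷-injectiveʳ e)
... | e1 , e2 = cong₂ node (codeLR-node-injective a1 a2 a1′ a2′ hxy hxy′ e1) (codeR-node-injective c d c′ d′ hy hy′ e2)
codeR-node-injective leaf (node c d) _ _ (_ , () , _) _ _
codeR-node-injective _ _ leaf (node c d) _ (_ , () , _) _

codeLR-injective leaf leaf _ _ _ = refl
codeLR-injective leaf (node a b) _ _ ()
codeLR-injective (node a b) leaf _ _ ()
codeLR-injective (node a b) (node a′ b′) h h′ e = codeLR-node-injective a b a′ b′ h h′ (∷-injectiveʳ e)

codeLR-node-injective a leaf a′ leaf h h′ e = cong (λ t → node t leaf) (codeLR-injective a a′ h h′ e)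
codeLR-node-injective leaf leaf (node a1 a2) (node c d) _ _ ()
codeLR-node-injective (node a1 a2) leaf (node a1′ a2′) (node c d) h _ e = ⊥-elim
    (startsUp-contra (proj₂ (codeLR-node-Motzkin a1 a2 h)) (∷-injectiveʳ e))
codeLR-node-injective (node a1 a2) (node c d) leaf leaf _ _ ()
codeLR-node-injective (node a1 a2) (node c d) (node a1′ a2′) leaf _ h e = ⊥-elim
    (startsUp-contra (proj₂ (codeLR-node-Motzkin a1′ a2′ h)) (sym (∷-injectiveʳ e)))
codeLR-node-injective (node a1 a2) (node c d) (node a1′ a2′) (node c′ d′) (hxy , _ , hxy2 , ns) (hxy′ , _ , hxy2′ , ns′) e
  with arch-injective (codeLR-node a1 a2) (codeLR⁻ c d) (codeLR-node a1′ a2′) (codeLR⁻ c′ d′)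
      (proj₁ (proj₁ (codeLR-node-Motzkin a1 a2 hxy))) (proj₁ (proj₁ (codeLR-node-Motzkin a1′ a2′ hxy′)))
      (∷-injectiveʳ (∷-injectiveʳ e))
... | e1 , e2 = cong₂ node (codeLR-node-injective a1 a2 a1′ a2′ hxy hxy′ e1) (codeLR⁻-injective c d c′ d′ hxy2 ns hxy2′ ns′ e2)
codeLR-node-injective leaf (node c d) _ _ (_ , () , _) _ _
codeLR-node-injective _ _ leaf (node c d) _ (_ , () , _) _

codeLR⁻-injective leaf leaf _ _ _ () _ _ _
codeLR⁻-injective _ _ leaf leaf _ _ _ () _
codeLR⁻-injective (node c1 c2) leaf (node c1′ c2′) leaf h _ h′ _ e = cong (λ t → node t leaf) (codeLR-node-injective c1 c2 c1′ c2′ h h′ e)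
codeLR⁻-injective (node c1 c2) leaf (node c1′ c2′) (node e f) h _ _ _ q = ⊥-elim (startsUp-contra (proj₂ (codeLR-node-Motzkin c1 c2 h)) q)
codeLR⁻-injective (node c1 c2) (node e f) (node c1′ c2′) leaf _ _ h _ q = ⊥-elim (startsUp-contra (proj₂ (codeLR-node-Motzkin c1′ c2′ h)) (sym q))
codeLR⁻-injective (node c1 c2) (node e f) (node c1′ c2′) (node e′ f′) (hxy , _ , hxy2 , ns) _ (hxy′ , _ , hxy2′ , ns′) _ q
  with arch-injective (codeLR-node c1 c2) (codeLR⁻ e f) (codeLR-node c1′ c2′) (codeLR⁻ e′ f′)
      (proj₁ (proj₁ (codeLR-node-Motzkin c1 c2 hxy))) (proj₁ (proj₁ (codeLR-node-Motzkin c1′ c2′ hxy′))) (∷-injectiveʳ q)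
... | e1 , e2 = cong₂ node (codeLR-node-injective c1 c2 c1′ c2′ hxy hxy′ e1) (codeLR⁻-injective e f e′ f′ hxy2 ns hxy2′ ns′ e2)
codeLR⁻-injective leaf (node e f) _ _ (_ , () , _) _ _ _ _
codeLR⁻-injective _ _ leaf (node e f) _ _ (_ , () , _) _ _

noUU-arch⁻ : ∀ P Q → noUU (P ++ D ∷ Q) ≡ true → noUU P ≡ true × noUU Q ≡ true
noUU-arch⁻ [] Q e = refl , e
noUU-arch⁻ (U ∷ []) Q e = refl , e
noUU-arch⁻ (U ∷ U ∷ P) Q ()
noUU-arch⁻ (U ∷ D ∷ P) Q e = noUU-arch⁻ (D ∷ P) Q e
noUU-arch⁻ (U ∷ L ∷ P) Q e = noUU-arch⁻ (L ∷ P) Q e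
noUU-arch⁻ (D ∷ P) Q e = noUU-arch⁻ P Q e
noUU-arch⁻ (L ∷ P) Q e = noUU-arch⁻ P Q e

noUU-U⁻ : ∀ P Q → noUU (U ∷ P ++ D ∷ Q) ≡ true → startsUp P ≡ false × noUU (P ++ D ∷ Q) ≡ true
noUU-U⁻ [] Q e = refl , e
noUU-U⁻ (U ∷ P) Q ()
noUU-U⁻ (D ∷ P) Q e = refl , e
noUU-U⁻ (L ∷ P) Q e = refl , e

length-arch⁻ : ∀ n P Q → length (P ++ D ∷ Q) ≤ n → length P ≤ n × length Q ≤ n
length-arch⁻ n P Q le rewrite length-++ P {D ∷ Q} =
  ≤-trans (m≤m+n (length P) _) le , ≤-trans (≤-trans (n≤1+n _) (m≤n+m (suc (length Q)) (length P))) le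

decompose-U : ∀ n r → length r ≤ n → validFrom 1 r ≡ true → noUU (U ∷ r) ≡ true →
  Σ (List Step) (λ P → Σ (List Step) (λ Q → r ≡ P ++ D ∷ Q × Motzkin P × startsUp P ≡ false × Motzkin Q × length P ≤ n × length Q ≤ n))
decompose-U n r le v nu with arch-split 0 0 r v
... | P , Q , refl , vP , vQ with noUU-U⁻ P Q nu
... | hP , nu′ with noUU-arch⁻ P Q nu′ | length-arch⁻ n P Q le
... | nP , nQ | lP , lQ = P , Q , refl , (vP , nP) , hP , (vQ , nQ) , lP , lQ

parse : ∀ n p → length p ≤ n → Motzkin p → Σ Tree (λ t → Gram t × code t ≡ p)
parseL : ∀ n p → length p ≤ n → Motzkin p → startsUp p ≡ false → Σ Tree (λ t → GramL t × codeL t ≡ p)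
parseR-node : ∀ n q → length q ≤ n → Motzkin q → Σ Tree (λ a → Σ Tree (λ b → GramR (node a b) × codeR-node a b ≡ q))
parseLR-node : ∀ n q → length q ≤ n → Motzkin q → startsUp q ≡ false → Σ Tree (λ a → Σ Tree (λ b → GramLR (node a b) × codeLR-node a b ≡ q))
parseLR⁻ : ∀ n q → length q ≤ n → Motzkin q → Σ Tree (λ c → Σ Tree (λ d → GramLR (node c d) × NotSingleton c d × codeLR⁻ c d ≡ q))

parse n [] _ _ = leaf , tt , refl
parse zero (_ ∷ _) () _
parse (suc n) (L ∷ p) (s≤s le) m with parse n p le m
... | a , h , e = node a leaf , h , cong (L ∷_) e
parse (suc n) (U ∷ r) (s≤s le) (v , nu) with decompose-U n r le v nu
... | P , Q , refl , mP , hP , mQ , lP , lQ with parseL n P lP mP hP | parseR-node n Q lQ mQ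
... | a , ha , refl | c , d , hcd , refl = node a (node c d) , (ha , hcd) , refl
parse (suc n) (D ∷ r) _ (() , _)

parseL n [] _ _ _ = leaf , tt , refl
parseL zero (_ ∷ _) () _ _
parseL (suc n) (U ∷ _) _ _ ()
parseL (suc n) (D ∷ _) _ (() , _) _
parseL (suc n) (L ∷ []) (s≤s le) m _ with parseL n [] le m refl
... | a , h , e = node a leaf , h , cong (L ∷_) e
parseL (suc n) (L ∷ L ∷ p) (s≤s le) m _ with parseL n (L ∷ p) le m refl
... | a , h , e = node a leaf , h , cong (L ∷_) e
parseL (suc n) (L ∷ D ∷ p) (s≤s le) (() , _) _
parseL (suc n) (L ∷ U ∷ r) (s≤s le) (v , nu) _ with decompose-U n r (≤-trans (n≤1+n _) le) v nu
... | P , Q , refl , mP , hP , mQ , lP , lQ with parseL n P lP mP hP | parseLR⁻ n Q lQ mQ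
... | a , ha , refl | c , d , hcd , ns , refl = node a (node c d) , (ha , hcd , ns) , refl

parseR-node n [] _ _ = leaf , leaf , tt , refl
parseR-node zero (_ ∷ _) () _
parseR-node (suc n) (L ∷ q) (s≤s le) m with parseR-node n q le m
... | a1 , a2 , h , e = node a1 a2 , leaf , h , cong (L ∷_) e
parseR-node (suc n) (U ∷ r) (s≤s le) (v , nu) with decompose-U n r le v nu
... | P , Q , refl , mP , hP , mQ , lP , lQ with parseLR-node n P lP mP hP | parseR-node n Q lQ mQ
... | a1 , a2 , ha , refl | c , d , hcd , refl = node a1 a2 , node c d , (ha , refl , hcd) , refl
parseR-node (suc n) (D ∷ r) _ (() , _)

parseLR-node n [] _ _ _ = leaf , leaf , tt , refl
parseLR-node zero (_ ∷ _) () _ _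
parseLR-node (suc n) (U ∷ _) _ _ ()
parseLR-node (suc n) (D ∷ _) _ (() , _) _
parseLR-node (suc n) (L ∷ []) (s≤s le) m _ with parseLR-node n [] le m refl
... | a1 , a2 , h , e = node a1 a2 , leaf , h , cong (L ∷_) e
parseLR-node (suc n) (L ∷ L ∷ p) (s≤s le) m _ with parseLR-node n (L ∷ p) le m refl
... | a1 , a2 , h , e = node a1 a2 , leaf , h , cong (L ∷_) e
parseLR-node (suc n) (L ∷ D ∷ p) (s≤s le) (() , _) _
parseLR-node (suc n) (L ∷ U ∷ r) (s≤s le) (v , nu) _ with decompose-U n r (≤-trans (n≤1+n _) le) v nu
... | P , Q , refl , mP , hP , mQ , lP , lQ with parseLR-node n P lP mP hP | parseLR⁻ n Q lQ mQ
... | a1 , a2 , ha , refl | c , d , hcd , ns , refl = node a1 a2 , node c d , (ha , refl , hcd , ns) , refl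

parseLR⁻ n [] _ _ = node leaf leaf , leaf , tt , tt , refl
parseLR⁻ zero (_ ∷ _) () _
parseLR⁻ (suc n) (L ∷ q) le m with parseLR-node (suc n) (L ∷ q) le m refl
... | c1 , c2 , h , e = node c1 c2 , leaf , h , tt , e
parseLR⁻ (suc n) (U ∷ r) (s≤s le) (v , nu) with decompose-U n r le v nu
... | P , Q , refl , mP , hP , mQ , lP , lQ with parseLR-node n P lP mP hP | parseLR⁻ n Q lQ mQ
... | c1 , c2 , ha , refl | e , f , hef , ns , refl = node c1 c2 , node e f , (ha , refl , hef , ns) , tt , refl
parseLR⁻ (suc n) (D ∷ r) _ (() , _)

-- The enumerations of Defs.  Both `words n` and `allPaths` extend every word of
-- the previous length by each letter of an alphabet.
extend : ∀ {A : Set} → List A → List (List A) → List (List A)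
extend alphabet ws = concatMap (λ a → map (a ∷_) ws) alphabet

∈-extend⁺ : ∀ {A : Set} (alphabet : List A) ws {a w} → a ∈ alphabet → w ∈ ws → a ∷ w ∈ extend alphabet ws
∈-extend⁺ alphabet ws a∈ w∈ = ∈-concatMap⁺ (λ a → map (a ∷_) ws) (lose a∈ (∈-map⁺ (_ ∷_) w∈))

∈-extend⁻ : ∀ {A : Set} (alphabet : List A) ws {v} → v ∈ extend alphabet ws →
  Σ A (λ a → Σ (List A) (λ w → v ≡ a ∷ w × a ∈ alphabet × w ∈ ws))
∈-extend⁻ alphabet ws q with find (∈-concatMap⁻ (λ a → map (a ∷_) ws) {xs = alphabet} q)
... | a , a∈ , r with ∈-map⁻ (a ∷_) r
... | w , w∈ , refl = a , w , refl , a∈ , w∈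

unique-extend : ∀ {A : Set} {alphabet : List A} {ws} → Unique alphabet → Unique ws → Unique (extend alphabet ws)
unique-extend {alphabet = []} _ _ = []
unique-extend {alphabet = a ∷ as} {ws} (a∉ ∷ u) uws = Unique.++⁺ (Unique.map⁺ ∷-injectiveʳ uws) (unique-extend u uws) disjoint
  where
  disjoint : ∀ {v} → ¬ (v ∈ map (a ∷_) ws × v ∈ extend as ws)
  disjoint (p , q) with ∈-map⁻ (a ∷_) p | ∈-extend⁻ as ws q
  ... | w , _ , refl | a′ , w′ , e , a′∈ , _ = All.lookup a∉ a′∈ (proj₁ (∷-injective e))

∈[1…]⁻ : ∀ {k n} → k ∈ [1… n ] → 0 < k × k ≤ n
∈[1…]⁻ p with ∈-applyUpTo⁻ suc p
... | i , i<n , refl = s≤s z≤n , i<n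

unique-[1…] : ∀ n → Unique [1… n ]
unique-[1…] n = Unique.applyUpTo⁺₁ suc n (λ i<j _ e → <-irrefl (suc-injective e) i<j)

∈-words⁺ : ∀ n m w → length w ≡ m → (∀ {v} → v ∈ w → 0 < v × v ≤ n) → w ∈ words n m
∈-words⁺ n zero [] _ _ = here refl
∈-words⁺ n (suc m) (v ∷ w) l h =
  ∈-extend⁺ [1… n ] (words n m) (∈[1…]⁺ (proj₁ (h (here refl))) (proj₂ (h (here refl)))) (∈-words⁺ n m w (suc-injective l) (λ q → h (there q)))

∈-words⁻ : ∀ n m {w} → w ∈ words n m → length w ≡ m × (∀ {v} → v ∈ w → 0 < v × v ≤ n)
∈-words⁻ n zero (here refl) = refl , (λ ())
∈-words⁻ n zero (there ())
∈-words⁻ n (suc m) q with ∈-extend⁻ [1… n ] (words n m) q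
... | a , w , refl , a∈ , w∈ = cong suc (proj₁ (∈-words⁻ n m w∈))
                             , λ { (here refl) → ∈[1…]⁻ a∈ ; (there r) → proj₂ (∈-words⁻ n m w∈) r }

unique-words : ∀ n m → Unique (words n m)
unique-words n zero = [] ∷ []
unique-words n (suc m) = unique-extend (unique-[1…] n) (unique-words n m)

∈-allPaths⁺ : ∀ m p → length p ≡ m → p ∈ allPaths m
∈-allPaths⁺ zero [] _ = here refl
∈-allPaths⁺ (suc m) (s ∷ p) l = ∈-extend⁺ (U ∷ D ∷ L ∷ []) (allPaths m) (step∈ s) (∈-allPaths⁺ m p (suc-injective l))
  where
  step∈ : ∀ s → s ∈ U ∷ D ∷ L ∷ []
  step∈ U = here refl
  step∈ D = there (here refl)
  step∈ L = there (there (here refl))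

∈-allPaths⁻ : ∀ m {p} → p ∈ allPaths m → length p ≡ m
∈-allPaths⁻ zero (here refl) = refl
∈-allPaths⁻ zero (there ())
∈-allPaths⁻ (suc m) q with ∈-extend⁻ (U ∷ D ∷ L ∷ []) (allPaths m) q
... | _ , p , refl , _ , p∈ = cong suc (∈-allPaths⁻ m p∈)

unique-allPaths : ∀ m → Unique (allPaths m)
unique-allPaths zero = [] ∷ []
unique-allPaths (suc m) = unique-extend (((λ ()) ∷ (λ ()) ∷ []) ∷ ((λ ()) ∷ []) ∷ [] ∷ []) (unique-allPaths m)

unique-filterᵇ : ∀ {A : Set} (p : A → Bool) xs → Unique xs → Unique (filterᵇ p xs)
unique-filterᵇ p xs u = Unique.filter⁺ _ u

-- Defs.isPerm counts letters; for duplicate-free words the counts are 0 or 1.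
count-∈ : ∀ k w → k ∈ w → 0 < count k w
count-∈ k (x ∷ w) (here refl) rewrite ≡ᵇ-refl k = s≤s z≤n
count-∈ k (x ∷ w) (there q) with k ≡ᵇ x
... | true = s≤s z≤n
... | false = count-∈ k w q

count-∉ : ∀ k w → k ∉ w → count k w ≡ 0
count-∉ k [] _ = refl
count-∉ k (x ∷ w) n rewrite ≡ᵇ-false {k} {x} (λ e → n (here e)) = count-∉ k w (λ q → n (there q))

count-unique : ∀ k w → Unique w → k ∈ w → count k w ≡ 1
count-unique k (x ∷ w) (a ∷ u) (here refl) rewrite ≡ᵇ-refl k = cong suc (count-∉ k w (λ q → All.lookup a q refl))
count-unique k (x ∷ w) (a ∷ u) (there q) rewrite ≡ᵇ-false {k} {x} (λ e → All.lookup a q (sym e)) = count-unique k w u q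

count⇒unique : ∀ w → (∀ {v} → v ∈ w → count v w ≡ 1) → Unique w
count⇒unique [] _ = []
count⇒unique (x ∷ w) h = All.tabulate nx ∷ count⇒unique w h′
  where
  c0 : count x w ≡ 0
  c0 = suc-injective (trans (sym (cong (λ b → if b then suc (count x w) else count x w) (≡ᵇ-refl x))) (h (here refl)))
  nx : ∀ {v} → v ∈ w → x ≢ v
  nx q refl with count-∈ x w q
  ... | lt rewrite c0 = <-irrefl refl lt
  h′ : ∀ {v} → v ∈ w → count v w ≡ 1
  h′ {v} q with h (there q)
  ... | e rewrite ≡ᵇ-false {v} {x} (λ e' → nx q (sym e')) = e

isPerm⇒unique : ∀ n σ → σ ∈ words n n → isPerm n σ ≡ true → Unique σ
isPerm⇒unique n σ win e = count⇒unique σ (λ q → ≡ᵇ-true⁻ (all-true⁻ (λ k → count k σ ≡ᵇ 1) [1… n ] (proj₂ (∧-true⁻ _ _ e))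
  (∈[1…]⁺ (proj₁ (proj₂ (∈-words⁻ n n win) q)) (proj₂ (proj₂ (∈-words⁻ n n win) q)))))

isPerm-perm : ∀ t → isPerm (size t) (perm 0 t) ≡ true
isPerm-perm t = ∧-true⁺ (trans (cong (_≡ᵇ size t) (perm-length 0 t)) (≡ᵇ-refl (size t)))
  (all-true⁺ _ [1… size t ] (λ {k} q → trans (cong (_≡ᵇ 1) (count-unique k (perm 0 t) (perm-unique 0 t) (perm-complete 0 t k (proj₁ (∈[1…]⁻ q)) (proj₂ (∈[1…]⁻ q))))) refl))

noUUMotzkin : ℕ → List (List Step)
noUUMotzkin n = filterᵇ (λ p → isMotzkin p ∧ noUU p) (allPaths n)

unique-DRS : ∀ n → Unique (DRS n pattern132)
unique-DRS n = unique-filterᵇ _ _ (unique-filterᵇ _ _ (unique-words n n))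

unique-noUUMotzkin : ∀ n → Unique (noUUMotzkin n)
unique-noUUMotzkin n = unique-filterᵇ _ _ (unique-allPaths n)

isSimsun⇒BiSimsun : ∀ t → isSimsun (size t) (perm 0 t) ≡ true →
  isSimsun (size t) (inverse (size t) (perm 0 t)) ≡ true → BiSimsun t
isSimsun⇒BiSimsun t s s⁻¹ = isSimsun⇒Simsun t s , isSimsun⇒Simsun (star t) s⋆
  where
  s⋆ : isSimsun (size (star t)) (perm 0 (star t)) ≡ true
  s⋆ = subst₂ (λ m w → isSimsun m w ≡ true) (sym (size-star t)) (inverse-perm t) s⁻¹

DRS⇒tree : ∀ n {σ} → σ ∈ DRS n pattern132 → Σ Tree (λ t → Gram t × size t ≡ n × perm 0 t ≡ σ)
DRS⇒tree n {σ} q with ∈-filterᵇ⁻ _ (perms n) q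
... | q₁ , isDRS with ∈-filterᵇ⁻ _ (words n n) q₁ | ∧-true⁻ (avoids pattern132 σ) _ isDRS
... | q₂ , isP | av , sims with ∈-words⁻ n n q₂ | ∧-true⁻ (isSimsun n σ) (isSimsun n (inverse n σ)) sims
... | len , bnd | s , s⁻¹
  with avoider⇒perm n n 0 σ ≤-refl (isPerm⇒unique n σ q₂ isP) bnd len (avoids⇒Avoids132 σ av)
... | t , refl , refl = t , proj₂ (Gram⟺BiSimsun t) (isSimsun⇒BiSimsun t s s⁻¹) , refl , refl

tree⇒DRS : ∀ t → Gram t → perm 0 t ∈ DRS (size t) pattern132
tree⇒DRS t g = ∈-filterᵇ⁺ _ (perms (size t)) isPermutation
  (∧-true⁺ (Avoids132⇒avoids _ (perm-unique 0 t) (perm-Avoids132 0 t)) (∧-true⁺ (Simsun⇒isSimsun t (size t) sim) sim⁻¹))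
  where
  sim : Simsun t
  sim = proj₁ (proj₁ (Gram⟺BiSimsun t) g)
  sim⋆ : Simsun (star t)
  sim⋆ = proj₂ (proj₁ (Gram⟺BiSimsun t) g)
  isPermutation : perm 0 t ∈ perms (size t)
  isPermutation = ∈-filterᵇ⁺ _ (words (size t) (size t))
    (∈-words⁺ _ _ (perm 0 t) (perm-length 0 t) (perm-within 0 t)) (isPerm-perm t)
  sim⁻¹ : isSimsun (size t) (inverse (size t) (perm 0 t)) ≡ true
  sim⁻¹ = subst (λ w → isSimsun (size t) w ≡ true) (sym (inverse-perm t)) (Simsun⇒isSimsun (star t) (size t) sim⋆)

path⇒tree : ∀ n {p} → p ∈ noUUMotzkin n → Σ Tree (λ t → Gram t × size t ≡ n × code t ≡ p)
path⇒tree n {p} q with ∈-filterᵇ⁻ _ (allPaths n) q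
... | q₁ , mot with ∈-allPaths⁻ n q₁ | ∧-true⁻ _ _ mot
... | len | v , nu with parse n p (≤-reflexive len) (v , nu)
... | t , g , refl = t , g , trans (sym (code-length t g)) len , refl

tree⇒path : ∀ t → Gram t → code t ∈ noUUMotzkin (size t)
tree⇒path t g = ∈-filterᵇ⁺ _ (allPaths (size t)) (∈-allPaths⁺ _ _ (code-length t g))
  (∧-true⁺ (proj₁ (code-Motzkin t g)) (proj₂ (code-Motzkin t g)))

DRS≤paths : ∀ n → length (DRS n pattern132) ≤ length (noUUMotzkin n)
DRS≤paths n = length-≤-injection _ _ (unique-DRS n) (λ q → code (tree q)) code∈ code-inj
  where
  tree : ∀ {σ} → σ ∈ DRS n pattern132 → Tree
  tree q = proj₁ (DRS⇒tree n q)
  code∈ : ∀ {σ} (q : σ ∈ DRS n pattern132) → code (tree q) ∈ noUUMotzkin n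
  code∈ q with DRS⇒tree n q
  ... | t , g , refl , _ = tree⇒path t g
  code-inj : ∀ {σ σ′} (q : σ ∈ DRS n pattern132) (q′ : σ′ ∈ DRS n pattern132) → code (tree q) ≡ code (tree q′) → σ ≡ σ′
  code-inj q q′ e with DRS⇒tree n q | DRS⇒tree n q′
  ... | t , g , _ , refl | t′ , g′ , _ , refl = cong (perm 0) (code-injective t t′ g g′ e)

paths≤DRS : ∀ n → length (noUUMotzkin n) ≤ length (DRS n pattern132)
paths≤DRS n = length-≤-injection _ _ (unique-noUUMotzkin n) (λ q → perm 0 (tree q)) perm∈ perm-inj
  where
  tree : ∀ {p} → p ∈ noUUMotzkin n → Tree
  tree q = proj₁ (path⇒tree n q)
  perm∈ : ∀ {p} (q : p ∈ noUUMotzkin n) → perm 0 (tree q) ∈ DRS n pattern132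
  perm∈ q with path⇒tree n q
  ... | t , g , refl , _ = tree⇒DRS t g
  perm-inj : ∀ {p p′} (q : p ∈ noUUMotzkin n) (q′ : p′ ∈ noUUMotzkin n) → perm 0 (tree q) ≡ perm 0 (tree q′) → p ≡ p′
  perm-inj q q′ e with path⇒tree n q | path⇒tree n q′
  ... | t , _ , _ , refl | t′ , _ , _ , refl = cong code (perm-injective 0 t t′ e)

theorem4p2 : ∀ (n : ℕ) → 1 ≤ n → length (DRS n (1 ∷ 3 ∷ 2 ∷ [])) ≡ S n
theorem4p2 n _ = ≤-antisym (DRS≤paths n) (paths≤DRS n)
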